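{- Let $\mathbf f=f_0f_1f_2\cdots=0100\cdots$ be the Fibonacci word, $f_{t-1}=\lfloor (t+1)\gamma\rfloor-\lfloor t\gamma\rfloor$ ($t\ge1$), $\gamma=(3-\sqrt5)/2$, and let $T(i,m,n)=\sum_{k=0}^{m-1}\sum_{\ell=0}^{n-1}f_{i+k+\ell}$. Let $N(n)$ be the number of distinct values of $T(i,F_{3n}/2,F_{3n}/2)$ over $i\ge0$. Then $N(n)=\Theta(n)$ as $n\to\infty$.
   Context: Fibonacci numbers: $F_0=0$, $F_1=1$, $F_{t+1}=F_t+F_{t-1}$. -}

module Defs where

open import Data.Nat using (ℕ; zero; suc; _+_; _*_; _∸_; _≤ᵇ_)
open import Data.Bool using (Bool; true; false; if_then_else_; _∧_)

fib : ℕ → ℕ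
fib zero = 0
fib (suc zero) = 1
fib (suc (suc t)) = fib (suc t) + fib t

-- largest k ≤ n with p k (0 if none); used for downward-closed p with p 0 true
maxSat : (ℕ → Bool) → ℕ → ℕ
maxSat p zero = 0
maxSat p (suc k) = if p (suc k) then suc k else maxSat p k

-- k ≤ t·γ with γ = (3 - √5)/2, decided exactly:
--   2k ≤ 3t - t√5  ⇔  2k ≤ 3t  ∧  5t² ≤ (3t - 2k)²
belowTγ : ℕ → ℕ → Bool
belowTγ t k = (2 * k ≤ᵇ 3 * t) ∧ (5 * (t * t) ≤ᵇ (3 * t ∸ 2 * k) * (3 * t ∸ 2 * k))

-- ⌊ t γ ⌋  (since 0 < γ < 1, the floor lies in [0, t])
floorγ : ℕ → ℕ
floorγ t = maxSat (belowTγ t) t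

-- Fibonacci word: f_{t-1} = ⌊(t+1)γ⌋ - ⌊tγ⌋ (t ≥ 1), i.e. f_j = ⌊(j+2)γ⌋ - ⌊(j+1)γ⌋
fibWord : ℕ → ℕ
fibWord j = floorγ (j + 2) ∸ floorγ (j + 1)

Σ< : ℕ → (ℕ → ℕ) → ℕ
Σ< zero g = 0
Σ< (suc n) g = Σ< n g + g n

T : ℕ → ℕ → ℕ → ℕ
T i m n = Σ< m (λ k → Σ< n (λ ℓ → fibWord (i + k + ℓ)))

-- the side length F_{3n}/2 (F_{3n} is even)
side : ℕ → ℕ
side n = fib (3 * n) Data.Nat./ 2

{-# OPTIONS --safe #-}
module Submission where

-- The Fibonacci word is the Sturmian word f_j = ⌊(j+2)γ⌋ − ⌊(j+1)γ⌋, so the number of 1s in a factor of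
-- length L starting at y is ⌊Lγ⌋ plus a carry, which is 1 iff {(y+1)γ} + {Lγ} ≥ 1. Since
-- F_{3n}/2 = Σ_{j<n} F_{3j+1}, the square T(i, F_{3n}/2, F_{3n}/2) is a sum of n L-shaped layers, layer j
-- being made of factors of length F_{3j+1}. As {F_{3j+1}γ} lies within φ^(−3j−1) of an integer, one carry
-- value is rare at each level, and by the best-approximation property of the Fibonacci numbers two rare
-- positions are at least F_{3j+2} apart. Hence each layer takes at most three consecutive values and T at
-- most 2n + 1 values. Conversely T grows by at most 1 when i increases by 1, and at i = Σ_{b<n/2} F_{6b+4}
-- every odd layer has gained 1 while the even layers are unchanged, so all values from T(0) to
-- T(0) + ⌊n/2⌋ are attained.

open import Defs
open import Data.Product using (Σ; _×_; _,_; proj₁; proj₂; ∃; ∃₂)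
open import Data.Sum using (_⊎_; inj₁; inj₂)
open import Function.Base using (_∘_; _$_)
open import Relation.Binary.PropositionalEquality
open import Relation.Nullary using (¬_; yes; no)
open import Relation.Nullary.Negation using (contradiction)

module Floorγ where
  open import Data.Bool.Base using (Bool; true; false)
  import Data.Bool.Base as Bool
  open import Data.Bool.Properties using (T-∧)
  open import Data.Nat
  open import Data.Nat.Properties
  open import Data.Nat.Tactic.RingSolver using (solve-∀)
  open import Data.Unit using (tt)
  open import Function.Bundles using (Equivalence)

  maxSat-sound : ∀ (p : ℕ → Bool) t → Bool.T (p 0) → Bool.T (p (maxSat p t))
  maxSat-sound p zero    p0 = p0
  maxSat-sound p (suc t) p0 with p (suc t) in eq
  ... | true  = subst Bool.T (sym eq) tt
  ... | false = maxSat-sound p t p0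

  maxSat-maximal : ∀ (p : ℕ → Bool) {t k} → maxSat p t < k → k ≤ t → ¬ Bool.T (p k)
  maxSat-maximal p {zero}  k>0 k≤0 _ = <-irrefl refl (≤-trans k>0 k≤0)
  maxSat-maximal p {suc t} k>max k≤t pk with p (suc t) in eq
  ... | true  = <-irrefl refl (<-≤-trans k>max k≤t)
  ... | false with m≤n⇒m<n∨m≡n k≤t
  ...   | inj₁ k<1+t = maxSat-maximal p k>max (≤-pred k<1+t) pk
  ...   | inj₂ refl  = subst Bool.T eq pk

  m*m≤n*n⇒m≤n : ∀ {m n} → m * m ≤ n * n → m ≤ n
  m*m≤n*n⇒m≤n {m} {n} m²≤n² with m ≤? n
  ... | yes m≤n = m≤n
  ... | no  m≰n = contradiction m²≤n² (<⇒≱ (*-mono-< (≰⇒> m≰n) (≰⇒> m≰n)))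

  private
    square-of-product : ∀ x y → (x * y) * (x * y) ≡ (x * x) * (y * y)
    square-of-product = solve-∀

    square-of-scaled-product : ∀ c x y → c * (x * y) * (c * (x * y)) ≡ c * (x * x) * (c * (y * y))
    square-of-scaled-product = solve-∀

    square-+ : ∀ x y → (x + y) * (x + y) ≡ x * x + y * y + 2 * (x * y)
    square-+ = solve-∀

    scaled-square-+ : ∀ c x y → c * ((x + y) * (x + y)) ≡ c * (x * x) + c * (y * y) + 2 * (c * (x * y))
    scaled-square-+ = solve-∀

  c*x*y≤p*q : ∀ c {x y p q} → c * (x * x) ≤ p * p → c * (y * y) ≤ q * q → c * (x * y) ≤ p * q
  c*x*y≤p*q c {x} {y} {p} {q} hx hy = m*m≤n*n⇒m≤n
    (subst₂ _≤_ (sym (square-of-scaled-product c x y)) (sym (square-of-product p q)) (*-mono-≤ hx hy))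

  p*q≤c*x*y : ∀ c {x y p q} → p * p ≤ c * (x * x) → q * q ≤ c * (y * y) → p * q ≤ c * (x * y)
  p*q≤c*x*y c {x} {y} {p} {q} hx hy = m*m≤n*n⇒m≤n
    (subst₂ _≤_ (sym (square-of-product p q)) (sym (square-of-scaled-product c x y)) (*-mono-≤ hx hy))

  -- k ≤ t ·γ and t ·γ< k say k ≤ tγ and tγ < k. As 2tγ = 3t − t√5, both are decided in ℕ by the
  -- slack p = 3t − 2k: k ≤ tγ iff 2k ≤ 3t and p² ≥ 5t².
  infix 4 _≤_·γ _·γ<_

  record _≤_·γ (k t : ℕ) : Set where
    constructor below
    field
      slack       : ℕ
      slack-sum   : 2 * k + slack ≡ 3 * t
      slack-large : 5 * (t * t) ≤ slack * slack

  data _·γ<_ (t k : ℕ) : Set where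
    far  : 3 * t < 2 * k → t ·γ< k
    near : ∀ p → 2 * k + p ≡ 3 * t → p * p < 5 * (t * t) → t ·γ< k

  belowTγ⇒≤·γ : ∀ t k → Bool.T (belowTγ t k) → k ≤ t ·γ
  belowTγ⇒≤·γ t k bel =
    below (3 * t ∸ 2 * k) (m+[n∸m]≡n (≤ᵇ⇒≤ (2 * k) _ (proj₁ parts))) (≤ᵇ⇒≤ _ _ (proj₂ parts))
    where parts = Equivalence.to (T-∧ {2 * k ≤ᵇ 3 * t}) bel

  ≤·γ⇒belowTγ : ∀ {k t} → k ≤ t ·γ → Bool.T (belowTγ t k)
  ≤·γ⇒belowTγ {k} {t} (below p sum large) =
    Equivalence.from (T-∧ {2 * k ≤ᵇ 3 * t}) (≤⇒≤ᵇ 2k≤3t , ≤⇒≤ᵇ (subst (λ q → 5 * (t * t) ≤ q * q) (sym p≡) large))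
    where
    2k≤3t : 2 * k ≤ 3 * t
    2k≤3t = subst (2 * k ≤_) sum (m≤m+n (2 * k) p)
    p≡ : 3 * t ∸ 2 * k ≡ p
    p≡ = trans (cong (_∸ 2 * k) (sym sum)) (m+n∸m≡n (2 * k) p)

  0≤·γ : ∀ t → 0 ≤ t ·γ
  0≤·γ t = below (3 * t) refl (subst (5 * (t * t) ≤_) (nine t) (*-monoˡ-≤ (t * t) (m≤m+n 5 4)))
    where
    nine : ∀ t → 9 * (t * t) ≡ 3 * t * (3 * t)
    nine = solve-∀

  ≤·γ-antitone : ∀ {j k t} → j ≤ k → k ≤ t ·γ → j ≤ t ·γ
  ≤·γ-antitone {j} j≤k (below p sum large) with m≤n⇒∃[o]m+o≡n j≤k
  ... | d , refl = below (p + 2 * d) (trans (shift j p d) sum) (≤-trans large (*-mono-≤ p≤ p≤))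
    where
    p≤ = m≤m+n p (2 * d)
    shift : ∀ j p d → 2 * j + (p + 2 * d) ≡ 2 * (j + d) + p
    shift = solve-∀

  ≤·γ⇒≤ : ∀ {k t} → k ≤ t ·γ → k ≤ t
  ≤·γ⇒≤ {k} {t} (below p sum large) = *-cancelˡ-≤ 2 (+-cancelʳ-≤ t (2 * k) (2 * t) 2k+t≤2t+t)
    where
    three : ∀ t → 3 * t ≡ 2 * t + t
    three = solve-∀
    t≤p : t ≤ p
    t≤p = m*m≤n*n⇒m≤n (≤-trans (m≤m+n (t * t) (4 * (t * t))) large)
    2k+t≤2t+t : 2 * k + t ≤ 2 * t + t
    2k+t≤2t+t = subst (2 * k + t ≤_) (trans sum (three t)) (+-monoʳ-≤ (2 * k) t≤p)

  ≰·γ⇒·γ< : ∀ {k t} → ¬ (k ≤ t ·γ) → t ·γ< k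
  ≰·γ⇒·γ< {k} {t} k≰tγ with 2 * k ≤? 3 * t
  ... | no  2k≰3t = far (≰⇒> 2k≰3t)
  ... | yes 2k≤3t with 5 * (t * t) ≤? (3 * t ∸ 2 * k) * (3 * t ∸ 2 * k)
  ...   | yes large = contradiction (below _ (m+[n∸m]≡n 2k≤3t) large) k≰tγ
  ...   | no  small = near _ (m+[n∸m]≡n 2k≤3t) (≰⇒> small)

  ·γ<⇒≰ : ∀ {k t} → t ·γ< k → ¬ (k ≤ t ·γ)
  ·γ<⇒≰ {k} (far 3t<2k) (below p sum _) = <⇒≱ 3t<2k (subst (2 * k ≤_) sum (m≤m+n (2 * k) p))
  ·γ<⇒≰ {k} (near p sum small) (below q sum′ large)
    with +-cancelˡ-≡ (2 * k) p q (trans sum (sym sum′))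
  ... | refl = <⇒≱ small large

  private
    slack-+ : ∀ {a b x y p q} → 2 * a + p ≡ 3 * x → 2 * b + q ≡ 3 * y → 2 * (a + b) + (p + q) ≡ 3 * (x + y)
    slack-+ {a} {b} {x} {y} {p} {q} p-sum q-sum =
      trans (interchange a b p q) (trans (cong₂ _+_ p-sum q-sum) (sym (*-distribˡ-+ 3 x y)))
      where
      interchange : ∀ a b p q → 2 * (a + b) + (p + q) ≡ (2 * a + p) + (2 * b + q)
      interchange = solve-∀

  ≤·γ-+ : ∀ {a b x y} → a ≤ x ·γ → b ≤ y ·γ → a + b ≤ x + y ·γ
  ≤·γ-+ {a} {b} {x} {y} (below p p-sum p-large) (below q q-sum q-large) =
    below (p + q) (slack-+ {a} {b} {x} {y} p-sum q-sum)
      (subst₂ _≤_ (sym (scaled-square-+ 5 x y)) (sym (square-+ p q))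
        (+-mono-≤ (+-mono-≤ p-large q-large) (*-monoʳ-≤ 2 (c*x*y≤p*q 5 {x} {y} {p} {q} p-large q-large))))

  private
    <-by-balance : ∀ {r q u v} → r + u ≡ q + v → v < u → r < q
    <-by-balance {r} {q} {u} eq v<u = +-cancelʳ-< u r q (subst (_< q + u) (sym eq) (+-monoʳ-< q v<u))

    far-near : ∀ {a b x y q} → 3 * x < 2 * a → 2 * b + q ≡ 3 * y → q * q < 5 * (y * y) → x + y ·γ< a + b
    far-near {a} {b} {x} {y} {q} 3x<2a q-sum small with 2 * (a + b) ≤? 3 * (x + y)
    ... | no  2[a+b]≰3[x+y] = far (≰⇒> 2[a+b]≰3[x+y])
    ... | yes 2[a+b]≤3[x+y] = near r r-sum (begin-strict
        r * r                   ≤⟨ *-mono-≤ (<⇒≤ r<q) (<⇒≤ r<q) ⟩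
        q * q                   <⟨ small ⟩
        5 * (y * y)             ≤⟨ *-monoʳ-≤ 5 (*-mono-≤ (m≤n+m y x) (m≤n+m y x)) ⟩
        5 * ((x + y) * (x + y)) ∎)
      where
      open ≤-Reasoning
      r = 3 * (x + y) ∸ 2 * (a + b)
      r-sum : 2 * (a + b) + r ≡ 3 * (x + y)
      r-sum = m+[n∸m]≡n 2[a+b]≤3[x+y]
      regroup₁ : ∀ r a b → r + 2 * a + 2 * b ≡ 2 * (a + b) + r
      regroup₁ = solve-∀
      regroup₂ : ∀ x b q → 3 * x + (2 * b + q) ≡ q + 3 * x + 2 * b
      regroup₂ = solve-∀
      balance : r + 2 * a ≡ q + 3 * x
      balance = +-cancelʳ-≡ (2 * b) _ _ (begin-equality
        r + 2 * a + 2 * b   ≡⟨ regroup₁ r a b ⟩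
        2 * (a + b) + r     ≡⟨ r-sum ⟩
        3 * (x + y)         ≡⟨ *-distribˡ-+ 3 x y ⟩
        3 * x + 3 * y       ≡⟨ cong (3 * x +_) (sym q-sum) ⟩
        3 * x + (2 * b + q) ≡⟨ regroup₂ x b q ⟩
        q + 3 * x + 2 * b   ∎)
      r<q : r < q
      r<q = <-by-balance balance 3x<2a

  ·γ<-+ : ∀ {a b x y} → x ·γ< a → y ·γ< b → x + y ·γ< a + b
  ·γ<-+ {a} {b} {x} {y} (far 3x<2a) (far 3y<2b) =
    far (subst₂ _<_ (sym (*-distribˡ-+ 3 x y)) (sym (*-distribˡ-+ 2 a b)) (+-mono-< 3x<2a 3y<2b))
  ·γ<-+ {a} {b} {x} {y} (far 3x<2a) (near q q-sum small) = far-near {a} {b} {x} {y} 3x<2a q-sum small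
  ·γ<-+ {a} {b} {x} {y} (near p p-sum small) (far 3y<2b) =
    subst₂ _·γ<_ (+-comm y x) (+-comm b a) (far-near {b} {a} {y} {x} 3y<2b p-sum small)
  ·γ<-+ {a} {b} {x} {y} (near p p-sum p-small) (near q q-sum q-small) =
    near (p + q) (slack-+ {a} {b} {x} {y} p-sum q-sum)
      (subst₂ _<_ (sym (square-+ p q)) (sym (scaled-square-+ 5 x y))
        (+-mono-<-≤ (+-mono-< p-small q-small)
          (*-monoʳ-≤ 2 (p*q≤c*x*y 5 {x} {y} {p} {q} (<⇒≤ p-small) (<⇒≤ q-small)))))

  floorγ-≤·γ : ∀ t → floorγ t ≤ t ·γ
  floorγ-≤·γ t = belowTγ⇒≤·γ t (floorγ t) (maxSat-sound (belowTγ t) t (≤·γ⇒belowTγ (0≤·γ t)))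

  ≤·γ⇒≤floorγ : ∀ {k t} → k ≤ t ·γ → k ≤ floorγ t
  ≤·γ⇒≤floorγ {k} {t} k≤tγ with k ≤? floorγ t
  ... | yes k≤⌊tγ⌋ = k≤⌊tγ⌋
  ... | no  k≰⌊tγ⌋ = contradiction (≤·γ⇒belowTγ k≤tγ)
                       (maxSat-maximal (belowTγ t) (≰⇒> k≰⌊tγ⌋) (≤·γ⇒≤ k≤tγ))

  ≤floorγ⇒≤·γ : ∀ {k t} → k ≤ floorγ t → k ≤ t ·γ
  ≤floorγ⇒≤·γ {t = t} k≤⌊tγ⌋ = ≤·γ-antitone k≤⌊tγ⌋ (floorγ-≤·γ t)

  ·γ<-suc-floorγ : ∀ t → t ·γ< suc (floorγ t)
  ·γ<-suc-floorγ t = ≰·γ⇒·γ< (λ le → <-irrefl refl (≤·γ⇒≤floorγ le))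

  floorγ-unique : ∀ {k t} → k ≤ t ·γ → t ·γ< suc k → floorγ t ≡ k
  floorγ-unique k≤tγ tγ<1+k =
    ≤-antisym (≮⇒≥ λ k<⌊tγ⌋ → ·γ<⇒≰ tγ<1+k (≤floorγ⇒≤·γ k<⌊tγ⌋)) (≤·γ⇒≤floorγ k≤tγ)

  floorγ-superadditive : ∀ x y → floorγ x + floorγ y ≤ floorγ (x + y)
  floorγ-superadditive x y = ≤·γ⇒≤floorγ (≤·γ-+ (floorγ-≤·γ x) (floorγ-≤·γ y))

  floorγ-+-≤ : ∀ x y → floorγ (x + y) ≤ suc (floorγ x + floorγ y)
  floorγ-+-≤ x y = ≮⇒≥ λ 1+⌊x⌋+⌊y⌋<⌊x+y⌋ →
    ·γ<⇒≰ (·γ<-+ (·γ<-suc-floorγ x) (·γ<-suc-floorγ y))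
      (≤floorγ⇒≤·γ (subst (_≤ floorγ (x + y)) (cong suc (sym (+-suc _ _))) 1+⌊x⌋+⌊y⌋<⌊x+y⌋))

  carry : ℕ → ℕ → ℕ
  carry x y = floorγ (x + y) ∸ (floorγ x + floorγ y)

  floorγ-+ : ∀ x y → floorγ (x + y) ≡ floorγ x + floorγ y + carry x y
  floorγ-+ x y = sym (m+[n∸m]≡n (floorγ-superadditive x y))

  carry≤1 : ∀ x y → carry x y ≤ 1
  carry≤1 x y = ≤-trans (∸-monoˡ-≤ (floorγ x + floorγ y) (floorγ-+-≤ x y)) (≤-reflexive (m+n∸n≡m 1 (floorγ x + floorγ y)))

  carry≡0⊎1 : ∀ x y → carry x y ≡ 0 ⊎ carry x y ≡ 1
  carry≡0⊎1 x y with carry x y | carry≤1 x y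
  ... | 0 | _         = inj₁ refl
  ... | 1 | _         = inj₂ refl
  ... | 2+ _ | s≤s ()

  fib-pos : ∀ k → 1 ≤ fib (suc k)
  fib-pos zero    = ≤-refl
  fib-pos (suc k) = ≤-trans (fib-pos k) (m≤m+n _ _)

  fib-mono-≤ : ∀ m d → fib m ≤ fib (d + m)
  fib-mono-≤ m zero    = ≤-refl
  fib-mono-≤ m (suc d) = ≤-trans (fib-mono-≤ m d) (step (d + m))
    where
    step : ∀ k → fib k ≤ fib (suc k)
    step zero    = z≤n
    step (suc k) = m≤m+n _ _

  private
    transfer : ∀ {a b c d e} → a + b ≡ c + d → a + e ≡ c → b ≡ d + e
    transfer {a} {b} {c} {d} {e} sum a+e≡c = +-cancelˡ-≡ a b (d + e) (begin
      a + b       ≡⟨ sum ⟩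
      c + d       ≡⟨ cong (_+ d) (sym a+e≡c) ⟩
      a + e + d   ≡⟨ +-assoc a e d ⟩
      a + (e + d) ≡⟨ cong (a +_) (+-comm e d) ⟩
      a + (d + e) ∎)
      where open ≡-Reasoning

  fib-cassini-step : ∀ n → fib n * fib (2 + n) + fib (1 + n) * fib (3 + n)
                         ≡ fib (1 + n) * fib (1 + n) + fib (2 + n) * fib (2 + n)
  fib-cassini-step n = identity (fib n) (fib (1 + n))
    where
    identity : ∀ a b → a * (b + a) + b * (b + a + b) ≡ b * b + (b + a) * (b + a)
    identity = solve-∀

  fib-cassini-even : ∀ m → fib (2 * m) * fib (2 + 2 * m) + 1 ≡ fib (1 + 2 * m) * fib (1 + 2 * m)
  fib-cassini-odd  : ∀ m → fib (1 + 2 * m) * fib (3 + 2 * m) ≡ fib (2 + 2 * m) * fib (2 + 2 * m) + 1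

  fib-cassini-even zero    = refl
  fib-cassini-even (suc m) =
    subst (λ k → fib k * fib (2 + k) + 1 ≡ fib (1 + k) * fib (1 + k)) (sym (*-suc 2 m))
      (sym (transfer (sym (fib-cassini-step (1 + 2 * m))) (sym (fib-cassini-odd m))))
  fib-cassini-odd m = transfer (fib-cassini-step (2 * m)) (fib-cassini-even m)

  -- For t = b + c the slack of c is t + 2b, whose square t² + 4b(t + b) is 5t² ± 4 by Cassini's identity;
  -- so c is ⌊tγ⌋ or ⌊tγ⌋ + 1 according to the sign.
  floorγ-from-cassini⁺ : ∀ b c → 1 ≤ b → b * (b + c + b) ≡ (b + c) * (b + c) + 1 → floorγ (b + c) ≡ c
  floorγ-from-cassini⁺ (suc b) c _ cassini = floorγ-unique
    (below (p + 2) (sum b c) (subst (5 * (t * t) ≤_) (sym L²) (m≤m+n _ 4)))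
    (near p (sum′ b c) (subst (p * p <_) p²+4p (m<m+n (p * p) (s≤s z≤n))))
    where
    t = suc b + c
    p = t + 2 * b
    sum : ∀ b c → 2 * c + (suc b + c + 2 * b + 2) ≡ 3 * (suc b + c)
    sum = solve-∀
    sum′ : ∀ b c → 2 * suc c + (suc b + c + 2 * b) ≡ 3 * (suc b + c)
    sum′ = solve-∀
    square : ∀ b c → (suc b + c + 2 * b + 2) * (suc b + c + 2 * b + 2)
                   ≡ (suc b + c) * (suc b + c) + 4 * (suc b * (suc b + c + suc b))
    square = solve-∀
    L² : (p + 2) * (p + 2) ≡ 5 * (t * t) + 4
    L² = trans (square b c) (trans (cong (λ x → t * t + 4 * x) cassini) (five (t * t)))
      where
      five : ∀ x → x + 4 * (x + 1) ≡ 5 * x + 4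
      five = solve-∀
    p²+4p : p * p + 4 * p ≡ 5 * (t * t)
    p²+4p = +-cancelʳ-≡ 4 _ _ (trans (expand p) L²)
      where
      expand : ∀ p → p * p + 4 * p + 4 ≡ (p + 2) * (p + 2)
      expand = solve-∀

  floorγ-from-cassini⁻ : ∀ b c → 1 ≤ c → b * (b + c + b) + 1 ≡ (b + c) * (b + c) → suc (floorγ (b + c)) ≡ c
  floorγ-from-cassini⁻ b (suc c) _ cassini = cong suc (floorγ-unique {c} {t}
    (below (L + 2) (sum b c) (subst₂ _≤_ L²+4 (expand L) (m≤m+n (L * L + 4) (4 * L))))
    (near L (sum′ b c) (subst (L * L <_) L²+4 (m<m+n (L * L) (s≤s z≤n)))))
    where
    t = b + suc c
    L = t + 2 * b
    sum : ∀ b c → 2 * c + (b + suc c + 2 * b + 2) ≡ 3 * (b + suc c)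
    sum = solve-∀
    sum′ : ∀ b c → 2 * suc c + (b + suc c + 2 * b) ≡ 3 * (b + suc c)
    sum′ = solve-∀
    square : ∀ b t → (t + 2 * b) * (t + 2 * b) + 4 ≡ t * t + 4 * (b * (t + b) + 1)
    square = solve-∀
    five : ∀ x → x + 4 * x ≡ 5 * x
    five = solve-∀
    expand : ∀ L → L * L + 4 + 4 * L ≡ (L + 2) * (L + 2)
    expand = solve-∀
    L²+4 : L * L + 4 ≡ 5 * (t * t)
    L²+4 = trans (square b t) (trans (cong (λ x → t * t + 4 * x) cassini) (five (t * t)))

  floorγ-fib-even : ∀ m → floorγ (fib (2 + 2 * m)) ≡ fib (2 * m)
  floorγ-fib-even m = floorγ-from-cassini⁺ (fib (1 + 2 * m)) (fib (2 * m)) (fib-pos (2 * m)) (fib-cassini-odd m)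

  floorγ-fib-odd : ∀ m → suc (floorγ (fib (3 + 2 * m))) ≡ fib (1 + 2 * m)
  floorγ-fib-odd m = floorγ-from-cassini⁻ (fib (2 + 2 * m)) (fib (1 + 2 * m)) (fib-pos (2 * m))
    (subst (λ k → fib k * fib (2 + k) + 1 ≡ fib (1 + k) * fib (1 + k)) (*-suc 2 m) (fib-cassini-even (suc m)))

open Floorγ

module FractionalParts where
  open import Data.Nat as ℕ using (ℕ)
  import Data.Nat.Properties as ℕ
  open import Data.Integer using (ℤ; +_; -[1+_]; 0ℤ; 1ℤ; -1ℤ; _+_; _-_; -_; _*_; _≤_; +≤+)
  open import Data.Integer.Properties
  open import Data.Integer.Tactic.RingSolver using (solve-∀)
  open import Data.Empty using (⊥-elim)
  open import Relation.Binary.Structures using (IsPreorder)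
  open import Relation.Binary.Definitions using (_Respects₂_)
  import Relation.Binary.Reasoning.Base.Triple as Triple

  -- ⌊bγ⌋ for an integer b; for n > 0, ⌊−nγ⌋ = −⌊nγ⌋ − 1 because nγ is irrational.
  ⌊_·γ⌋ : ℤ → ℤ
  ⌊ + n ·γ⌋      = + floorγ n
  ⌊ -[1+ n ] ·γ⌋ = -[1+ floorγ (ℕ.suc n) ]

  data Bit : ℤ → Set where
    0b : Bit 0ℤ
    1b : Bit 1ℤ

  bit : ∀ {c} → c ℕ.≤ 1 → Bit (+ c)
  bit ℕ.z≤n         = 0b
  bit (ℕ.s≤s ℕ.z≤n) = 1b

  flip : ∀ {c} → Bit c → Bit (1ℤ - c)
  flip 0b = 1b
  flip 1b = 0b

  0≤bit : ∀ {c} → Bit c → 0ℤ ≤ c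
  0≤bit 0b = +≤+ ℕ.z≤n
  0≤bit 1b = +≤+ ℕ.z≤n

  AlmostAdditive : ℤ → ℤ → Set
  AlmostAdditive b d = ∃ λ c → Bit c × ⌊ b + d ·γ⌋ ≡ ⌊ b ·γ⌋ + ⌊ d ·γ⌋ + c

  almostAdditive-comm : ∀ {b d} → AlmostAdditive b d → AlmostAdditive d b
  almostAdditive-comm {b} {d} (c , c-bit , eq) =
    c , c-bit , trans (cong ⌊_·γ⌋ (+-comm d b)) (trans eq (cong (_+ c) (+-comm ⌊ b ·γ⌋ ⌊ d ·γ⌋)))

  -- Each sign pattern is rearranged into a sum of naturals, e.g. x + (−1 − y) = w into (1 + y) + w = x,
  -- whose carry c gives the integer carry c or 1 − c.
  almostAdditive-pos-neg-≥ : ∀ y w → AlmostAdditive (+ (ℕ.suc y ℕ.+ w)) -[1+ y ]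
  almostAdditive-pos-neg-≥ y w = 1ℤ - + c , flip (bit (carry≤1 (ℕ.suc y) w)) , (begin
    ⌊ + (ℕ.suc y ℕ.+ w) + -[1+ y ] ·γ⌋                 ≡⟨ cong ⌊_·γ⌋ (cancel (+ ℕ.suc y) (+ w)) ⟩
    + floorγ w                                         ≡⟨ regroup (+ A) (+ floorγ w) (+ c) ⟩
    + (A ℕ.+ floorγ w ℕ.+ c) + -[1+ A ] + (1ℤ - + c)   ≡⟨ cong (λ t → + t + -[1+ A ] + (1ℤ - + c)) (floorγ-+ (ℕ.suc y) w) ⟨
    ⌊ + (ℕ.suc y ℕ.+ w) ·γ⌋ + ⌊ -[1+ y ] ·γ⌋ + (1ℤ - + c) ∎)
    where
    open ≡-Reasoning
    A = floorγ (ℕ.suc y)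
    c = carry (ℕ.suc y) w
    cancel : ∀ a w → a + w - a ≡ w
    cancel = solve-∀
    regroup : ∀ a w c → w ≡ a + w + c - (1ℤ + a) + (1ℤ - c)
    regroup = solve-∀

  almostAdditive-pos-neg-< : ∀ x w → AlmostAdditive (+ x) -[1+ x ℕ.+ w ]
  almostAdditive-pos-neg-< x w = + c , bit (carry≤1 x (ℕ.suc w)) , (begin
    ⌊ + x + -[1+ x ℕ.+ w ] ·γ⌋                                   ≡⟨ cong ⌊_·γ⌋ (cancel (+ x) (+ w)) ⟩
    -[1+ floorγ (ℕ.suc w) ]                                     ≡⟨ regroup (+ floorγ x) (+ floorγ (ℕ.suc w)) (+ c) ⟩
    + floorγ x + -[1+ floorγ x ℕ.+ floorγ (ℕ.suc w) ℕ.+ c ] + + c ≡⟨ cong (λ t → + floorγ x + -[1+ t ] + + c) ⌊x+1+w⌋ ⟨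
    ⌊ + x ·γ⌋ + ⌊ -[1+ x ℕ.+ w ] ·γ⌋ + + c                        ∎)
    where
    open ≡-Reasoning
    c = carry x (ℕ.suc w)
    ⌊x+1+w⌋ : floorγ (ℕ.suc (x ℕ.+ w)) ≡ floorγ x ℕ.+ floorγ (ℕ.suc w) ℕ.+ c
    ⌊x+1+w⌋ = trans (cong floorγ (sym (ℕ.+-suc x w))) (floorγ-+ x (ℕ.suc w))
    cancel : ∀ x w → x - (1ℤ + (x + w)) ≡ - (1ℤ + w)
    cancel = solve-∀
    regroup : ∀ a b c → - (1ℤ + b) ≡ a - (1ℤ + (a + b + c)) + c
    regroup = solve-∀

  almostAdditive-neg-neg : ∀ x y → AlmostAdditive -[1+ x ] -[1+ y ]
  almostAdditive-neg-neg x y = 1ℤ - + c , flip (bit (carry≤1 (ℕ.suc x) (ℕ.suc y))) , (begin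
    -[1+ floorγ (ℕ.suc (ℕ.suc (x ℕ.+ y))) ] ≡⟨ cong (λ t → -[1+ floorγ (ℕ.suc t) ]) (ℕ.+-suc x y) ⟨
    -[1+ floorγ (ℕ.suc x ℕ.+ ℕ.suc y) ]     ≡⟨ cong -[1+_] (floorγ-+ (ℕ.suc x) (ℕ.suc y)) ⟩
    -[1+ A ℕ.+ B ℕ.+ c ]                    ≡⟨ regroup (+ A) (+ B) (+ c) ⟩
    -[1+ A ] + -[1+ B ] + (1ℤ - + c)        ∎)
    where
    open ≡-Reasoning
    A = floorγ (ℕ.suc x)
    B = floorγ (ℕ.suc y)
    c = carry (ℕ.suc x) (ℕ.suc y)
    regroup : ∀ a b c → - (1ℤ + (a + b + c)) ≡ - (1ℤ + a) - (1ℤ + b) + (1ℤ - c)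
    regroup = solve-∀

  almostAdditive : ∀ b d → AlmostAdditive b d
  almostAdditive (+ x) (+ y) = + carry x y , bit (carry≤1 x y) , cong +_ (floorγ-+ x y)
  almostAdditive (+ x) -[1+ y ] with ℕ.suc y ℕ.≤? x
  ... | yes 1+y≤x with ℕ.m≤n⇒∃[o]m+o≡n 1+y≤x
  ...   | w , refl = almostAdditive-pos-neg-≥ y w
  almostAdditive (+ x) -[1+ y ] | no 1+y≰x with ℕ.m≤n⇒∃[o]m+o≡n (ℕ.≤-pred (ℕ.≰⇒> 1+y≰x))
  ...   | w , refl = almostAdditive-pos-neg-< x w
  almostAdditive -[1+ x ] (+ y)    = almostAdditive-comm {+ y} { -[1+ x ]} (almostAdditive (+ y) -[1+ x ])
  almostAdditive -[1+ x ] -[1+ y ] = almostAdditive-neg-neg x y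

  ⌊·γ⌋-superadditive : ∀ b d → ⌊ b ·γ⌋ + ⌊ d ·γ⌋ ≤ ⌊ b + d ·γ⌋
  ⌊·γ⌋-superadditive b d with almostAdditive b d
  ... | c , c-bit , eq = subst (⌊ b ·γ⌋ + ⌊ d ·γ⌋ ≤_) (sym eq)
    (subst (_≤ ⌊ b ·γ⌋ + ⌊ d ·γ⌋ + c) (+-identityʳ (⌊ b ·γ⌋ + ⌊ d ·γ⌋)) (+-monoʳ-≤ (⌊ b ·γ⌋ + ⌊ d ·γ⌋) (0≤bit c-bit)))

  -- (a , b) stands for a + bγ, which is nonnegative iff −a ≤ ⌊bγ⌋.
  ℤ[γ] : Set
  ℤ[γ] = ℤ × ℤ

  infixl 6 _⊕_ _⊝_
  infix  8 ⊖_
  infixr 7 _·_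
  infix  4 _≤γ_ _<γ_

  _⊕_ : ℤ[γ] → ℤ[γ] → ℤ[γ]
  (a , b) ⊕ (c , d) = a + c , b + d

  ⊖_ : ℤ[γ] → ℤ[γ]
  ⊖ (a , b) = - a , - b

  _⊝_ : ℤ[γ] → ℤ[γ] → ℤ[γ]
  x ⊝ y = x ⊕ ⊖ y

  _·_ : ℤ → ℤ[γ] → ℤ[γ]
  u · (a , b) = u * a , u * b

  𝟘 𝟙 : ℤ[γ]
  𝟘 = 0ℤ , 0ℤ
  𝟙 = 1ℤ , 0ℤ

  NonNeg : ℤ[γ] → Set
  NonNeg (a , b) = - a ≤ ⌊ b ·γ⌋

  record _≤γ_ (x y : ℤ[γ]) : Set where
    constructor nonneg-diff
    field nonneg : NonNeg (y ⊝ x)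

  open _≤γ_

  _<γ_ : ℤ[γ] → ℤ[γ] → Set
  x <γ y = ¬ (y ≤γ x)

  NonNeg-⊕ : ∀ x y → NonNeg x → NonNeg y → NonNeg (x ⊕ y)
  NonNeg-⊕ (a , b) (c , d) x≥0 y≥0 =
    subst (_≤ ⌊ b + d ·γ⌋) (sym (neg-distrib-+ a c)) (≤-trans (+-mono-≤ x≥0 y≥0) (⌊·γ⌋-superadditive b d))

  NonNeg-total : ∀ x → NonNeg x ⊎ NonNeg (⊖ x)
  NonNeg-total (a , + ℕ.zero) with ≤-total (- a) 0ℤ
  ... | inj₁ -a≤0 = inj₁ -a≤0
  ... | inj₂ 0≤-a = inj₂ (neg-mono-≤ 0≤-a)
  NonNeg-total (a , + ℕ.suc n) with - a ≤? + floorγ (ℕ.suc n)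
  ... | yes x≥0 = inj₁ x≥0
  ... | no  x≱0 = inj₂ (neg-mono-≤ (i<j⇒suc[i]≤j (≰⇒> x≱0)))
  NonNeg-total (a , -[1+ n ]) with - a ≤? -[1+ floorγ (ℕ.suc n) ]
  ... | yes x≥0 = inj₁ x≥0
  ... | no  x≱0 = inj₂ (subst (_≤ _) (sym (neg-involutive a))
                         (neg-cancel-≤ (subst (_≤ - a) (raise (+ floorγ (ℕ.suc n))) (i<j⇒suc[i]≤j (≰⇒> x≱0)))))
    where
    raise : ∀ m → 1ℤ + - (1ℤ + m) ≡ - m
    raise = solve-∀

  private
    difference-chain : ∀ z y x → z - y + (y - x) ≡ z - x
    difference-chain = solve-∀
    difference-sum : ∀ y v x u → y + v - (x + u) ≡ y - x + (v - u)
    difference-sum = solve-∀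
    difference-cancel : ∀ y u x → y + u - (x + u) ≡ y - x
    difference-cancel = solve-∀
    difference-swap : ∀ x y → - (x - y) ≡ y - x
    difference-swap = solve-∀

  ≤γ-refl : ∀ {x} → x ≤γ x
  ≤γ-refl {a , b} = nonneg-diff (subst NonNeg (sym (cong₂ _,_ (+-inverseʳ a) (+-inverseʳ b))) ≤-refl)

  ≤γ-trans : ∀ {x y z} → x ≤γ y → y ≤γ z → x ≤γ z
  ≤γ-trans {x₁ , x₂} {y₁ , y₂} {z₁ , z₂} (nonneg-diff x≤y) (nonneg-diff y≤z) = nonneg-diff
    (subst NonNeg (cong₂ _,_ (difference-chain z₁ y₁ x₁) (difference-chain z₂ y₂ x₂)) (NonNeg-⊕ _ _ y≤z x≤y))

  ⊕-mono-≤γ : ∀ {x y u v} → x ≤γ y → u ≤γ v → x ⊕ u ≤γ y ⊕ v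
  ⊕-mono-≤γ {x₁ , x₂} {y₁ , y₂} {u₁ , u₂} {v₁ , v₂} (nonneg-diff x≤y) (nonneg-diff u≤v) = nonneg-diff
    (subst NonNeg (sym (cong₂ _,_ (difference-sum y₁ v₁ x₁ u₁) (difference-sum y₂ v₂ x₂ u₂))) (NonNeg-⊕ _ _ x≤y u≤v))

  ⊕-cancelʳ-≤γ : ∀ {x y} u → x ⊕ u ≤γ y ⊕ u → x ≤γ y
  ⊕-cancelʳ-≤γ {x₁ , x₂} {y₁ , y₂} (u₁ , u₂) (nonneg-diff x+u≤y+u) = nonneg-diff
    (subst NonNeg (cong₂ _,_ (difference-cancel y₁ u₁ x₁) (difference-cancel y₂ u₂ x₂)) x+u≤y+u)

  ⊕-cancelˡ-≤γ : ∀ {x y} u → u ⊕ x ≤γ u ⊕ y → x ≤γ y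
  ⊕-cancelˡ-≤γ {x₁ , x₂} {y₁ , y₂} (u₁ , u₂) (nonneg-diff u+x≤u+y) = nonneg-diff
    (subst NonNeg (cong₂ _,_ (cancel u₁ y₁ x₁) (cancel u₂ y₂ x₂)) u+x≤u+y)
    where
    cancel : ∀ u y x → u + y - (u + x) ≡ y - x
    cancel = solve-∀

  <γ⇒≤γ : ∀ {x y} → x <γ y → x ≤γ y
  <γ⇒≤γ {x₁ , x₂} {y₁ , y₂} x<y with NonNeg-total ((x₁ , x₂) ⊝ (y₁ , y₂))
  ... | inj₁ y≤x = contradiction (nonneg-diff y≤x) x<y
  ... | inj₂ x≤y = nonneg-diff (subst NonNeg (cong₂ _,_ (difference-swap x₁ y₁) (difference-swap x₂ y₂)) x≤y)

  ≤γ-<γ-trans : ∀ {x y z} → x ≤γ y → y <γ z → x <γ z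
  ≤γ-<γ-trans x≤y y<z z≤x = y<z (≤γ-trans z≤x x≤y)

  <γ-≤γ-trans : ∀ {x y z} → x <γ y → y ≤γ z → x <γ z
  <γ-≤γ-trans x<y y≤z z≤x = x<y (≤γ-trans y≤z z≤x)

  <γ-trans : ∀ {x y z} → x <γ y → y <γ z → x <γ z
  <γ-trans x<y = ≤γ-<γ-trans (<γ⇒≤γ x<y)

  <γ-asym : ∀ {x y} → x <γ y → ¬ (y <γ x)
  <γ-asym x<y y<x = y<x (<γ⇒≤γ x<y)

  ⊕-monoˡ-<γ : ∀ {x y} u → x <γ y → x ⊕ u <γ y ⊕ u
  ⊕-monoˡ-<γ u x<y y+u≤x+u = x<y (⊕-cancelʳ-≤γ u y+u≤x+u)

  ⊕-monoʳ-<γ : ∀ {x y} u → x <γ y → u ⊕ x <γ u ⊕ y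
  ⊕-monoʳ-<γ u x<y u+y≤u+x = x<y (⊕-cancelˡ-≤γ u u+y≤u+x)

  ≤γ-⊕⇒⊝-≤γ : ∀ {x y} r → x ≤γ y ⊕ r → x ⊝ r ≤γ y
  ≤γ-⊕⇒⊝-≤γ {x₁ , x₂} {y₁ , y₂} (r₁ , r₂) (nonneg-diff x≤y+r) =
    nonneg-diff (subst NonNeg (cong₂ _,_ (move x₁ y₁ r₁) (move x₂ y₂ r₂)) x≤y+r)
    where
    move : ∀ x y r → y + r - x ≡ y - (x - r)
    move = solve-∀

  ⊕-<γ⇒<γ-⊝ : ∀ {x y} r → x ⊕ r <γ y → x <γ y ⊝ r
  ⊕-<γ⇒<γ-⊝ {x₁ , x₂} {y₁ , y₂} (r₁ , r₂) x+r<y (nonneg-diff y-r≤x) =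
    x+r<y (nonneg-diff (subst NonNeg (cong₂ _,_ (move x₁ y₁ r₁) (move x₂ y₂ r₂)) y-r≤x))
    where
    move : ∀ x y r → x - (y - r) ≡ x + r - y
    move = solve-∀

  ≤γ-isPreorder : IsPreorder _≡_ _≤γ_
  ≤γ-isPreorder = record
    { isEquivalence = isEquivalence
    ; reflexive     = λ { refl → ≤γ-refl }
    ; trans         = ≤γ-trans
    }

  <γ-resp-≡ : _<γ_ Respects₂ _≡_
  <γ-resp-≡ = (λ { refl x<y → x<y }) , (λ { refl x<y → x<y })

  module ≤γ-Reasoning = Triple ≤γ-isPreorder <γ-asym <γ-trans <γ-resp-≡ <γ⇒≤γ <γ-≤γ-trans ≤γ-<γ-trans

  NonNeg⇒𝟘≤γ : ∀ {x} → NonNeg x → 𝟘 ≤γ x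
  NonNeg⇒𝟘≤γ {a , b} = nonneg-diff ∘ subst NonNeg (sym (cong₂ _,_ (+-identityʳ a) (+-identityʳ b)))

  𝟘≤γ⇒NonNeg : ∀ {x} → 𝟘 ≤γ x → NonNeg x
  𝟘≤γ⇒NonNeg {a , b} = subst NonNeg (cong₂ _,_ (+-identityʳ a) (+-identityʳ b)) ∘ nonneg

  ≤γ𝟘⇒NonNeg : ∀ {x} → x ≤γ 𝟘 → NonNeg (⊖ x)
  ≤γ𝟘⇒NonNeg {a , b} = subst NonNeg (cong₂ _,_ (+-identityˡ (- a)) (+-identityˡ (- b))) ∘ nonneg

  ≤γ𝟘⇒𝟘≤γ⊖ : ∀ {x} → x ≤γ 𝟘 → 𝟘 ≤γ ⊖ x
  ≤γ𝟘⇒𝟘≤γ⊖ = NonNeg⇒𝟘≤γ ∘ ≤γ𝟘⇒NonNeg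

  <γ𝟘⇒𝟘<γ⊖ : ∀ {x} → x <γ 𝟘 → 𝟘 <γ ⊖ x
  <γ𝟘⇒𝟘<γ⊖ {a , b} x<𝟘 ⊖x≤𝟘 = x<𝟘 (subst (𝟘 ≤γ_) (cong₂ _,_ (neg-involutive a) (neg-involutive b)) (≤γ𝟘⇒𝟘≤γ⊖ ⊖x≤𝟘))

  𝟘≤γ⇒⊖≤γ𝟘 : ∀ {x} → 𝟘 ≤γ x → ⊖ x ≤γ 𝟘
  𝟘≤γ⇒⊖≤γ𝟘 {a , b} 𝟘≤x = nonneg-diff
    (subst NonNeg (cong₂ _,_ (double-neg a) (double-neg b)) (𝟘≤γ⇒NonNeg 𝟘≤x))
    where
    double-neg : ∀ a → a ≡ 0ℤ - - a
    double-neg = solve-∀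

  𝟘≤γ-scale : ∀ n {x} → 𝟘 ≤γ x → 𝟘 ≤γ + n · x
  𝟘≤γ-scale 0         _   = ≤γ-refl
  𝟘≤γ-scale (ℕ.suc n) {a , b} 𝟘≤x =
    subst (𝟘 ≤γ_) (sym (cong₂ _,_ (step (+ n) a) (step (+ n) b))) (⊕-mono-≤γ 𝟘≤x (𝟘≤γ-scale n 𝟘≤x))
    where
    step : ∀ n a → (1ℤ + n) * a ≡ a + n * a
    step = solve-∀

  -- (- ⌊zγ⌋ , z) stands for the fractional part {zγ} = zγ − ⌊zγ⌋.
  frac : ℕ → ℤ[γ]
  frac z = - + floorγ z , + z

  𝟘≤frac : ∀ z → 𝟘 ≤γ frac z
  𝟘≤frac z = NonNeg⇒𝟘≤γ (≤-reflexive (neg-involutive (+ floorγ z)))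

  frac<𝟙 : ∀ z → frac z <γ 𝟙
  frac<𝟙 z (nonneg-diff 𝟙≤frac) = ℕ.<-irrefl refl (drop‿+≤+
    (subst₂ _≤_ (step (+ floorγ z)) (cong (λ n → + floorγ n) (ℕ.+-identityʳ z)) 𝟙≤frac))
    where
    step : ∀ g → - (- g - 1ℤ) ≡ 1ℤ + g
    step = solve-∀

  carry≡0⇒frac-+ : ∀ x y → carry x y ≡ 0 → frac (x ℕ.+ y) ≡ frac x ⊕ frac y
  carry≡0⇒frac-+ x y c≡0 = cong₂ _,_ (begin
    - + floorγ (x ℕ.+ y)                           ≡⟨ cong (λ n → - + n) (floorγ-+ x y) ⟩
    - + (floorγ x ℕ.+ floorγ y ℕ.+ carry x y)      ≡⟨ cong (λ c → - + (floorγ x ℕ.+ floorγ y ℕ.+ c)) c≡0 ⟩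
    - (+ floorγ x + + floorγ y + 0ℤ)               ≡⟨ split (+ floorγ x) (+ floorγ y) ⟩
    - + floorγ x + - + floorγ y                    ∎) refl
    where
    open ≡-Reasoning
    split : ∀ a b → - (a + b + 0ℤ) ≡ - a + - b
    split = solve-∀

  carry≡1⇒frac-+ : ∀ x y → carry x y ≡ 1 → frac (x ℕ.+ y) ⊕ 𝟙 ≡ frac x ⊕ frac y
  carry≡1⇒frac-+ x y c≡1 = cong₂ _,_ (begin
    - + floorγ (x ℕ.+ y) + 1ℤ                      ≡⟨ cong (λ n → - + n + 1ℤ) (floorγ-+ x y) ⟩
    - + (floorγ x ℕ.+ floorγ y ℕ.+ carry x y) + 1ℤ ≡⟨ cong (λ c → - + (floorγ x ℕ.+ floorγ y ℕ.+ c) + 1ℤ) c≡1 ⟩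
    - (+ floorγ x + + floorγ y + 1ℤ) + 1ℤ          ≡⟨ split (+ floorγ x) (+ floorγ y) ⟩
    - + floorγ x + - + floorγ y                    ∎) (+-identityʳ (+ (x ℕ.+ y)))
    where
    open ≡-Reasoning
    split : ∀ a b → - (a + b + 1ℤ) + 1ℤ ≡ - a + - b
    split = solve-∀

  carry≡1⇒𝟙≤ : ∀ x y → carry x y ≡ 1 → 𝟙 ≤γ frac x ⊕ frac y
  carry≡1⇒𝟙≤ x y c≡1 =
    subst (𝟙 ≤γ_) (carry≡1⇒frac-+ x y c≡1) (⊕-mono-≤γ (𝟘≤frac (x ℕ.+ y)) (≤γ-refl {𝟙}))

  carry≡0⇒<𝟙 : ∀ x y → carry x y ≡ 0 → frac x ⊕ frac y <γ 𝟙
  carry≡0⇒<𝟙 x y c≡0 = subst (_<γ 𝟙) (carry≡0⇒frac-+ x y c≡0) (frac<𝟙 (x ℕ.+ y))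

  𝟙≤⇒carry≡1 : ∀ x y → 𝟙 ≤γ frac x ⊕ frac y → carry x y ≡ 1
  𝟙≤⇒carry≡1 x y 𝟙≤ with carry≡0⊎1 x y
  ... | inj₁ c≡0 = contradiction 𝟙≤ (carry≡0⇒<𝟙 x y c≡0)
  ... | inj₂ c≡1 = c≡1

  <𝟙⇒carry≡0 : ∀ x y → frac x ⊕ frac y <γ 𝟙 → carry x y ≡ 0
  <𝟙⇒carry≡0 x y <𝟙 with carry≡0⊎1 x y
  ... | inj₁ c≡0 = c≡0
  ... | inj₂ c≡1 = contradiction (carry≡1⇒𝟙≤ x y c≡1) <𝟙

  frac-+ : ∀ x y → frac x ⊕ frac y <γ 𝟙 → frac (x ℕ.+ y) ≡ frac x ⊕ frac y
  frac-+ x y <𝟙 = carry≡0⇒frac-+ x y (<𝟙⇒carry≡0 x y <𝟙)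

  -- ε k = F(k+1)γ − F(k−1), reading F(−1) = 1. It equals (−1/φ)^(k+1): the signs alternate and |ε k| decreases.
  ε : ℕ → ℤ[γ]
  ε 0 = -1ℤ , 1ℤ
  ε 1 = 0ℤ , 1ℤ
  ε (ℕ.suc (ℕ.suc k)) = ε k ⊕ ε (ℕ.suc k)

  ε-suc : ∀ k → ε (ℕ.suc k) ≡ (- + fib k , + fib (2 ℕ.+ k))
  ε-suc 0 = refl
  ε-suc 1 = refl
  ε-suc (ℕ.suc (ℕ.suc k)) = begin
    ε (ℕ.suc k) ⊕ ε (2 ℕ.+ k)                                    ≡⟨ cong₂ _⊕_ (ε-suc k) (ε-suc (ℕ.suc k)) ⟩
    (- + fib k + - + fib (1 ℕ.+ k) , + (fib (2 ℕ.+ k) ℕ.+ fib (3 ℕ.+ k)))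
      ≡⟨ cong₂ _,_ (sym (trans (cong (λ n → - + n) (ℕ.+-comm (fib (1 ℕ.+ k)) (fib k))) (neg-distrib-+ (+ fib k) (+ fib (1 ℕ.+ k)))))
                   (cong +_ (ℕ.+-comm (fib (2 ℕ.+ k)) (fib (3 ℕ.+ k)))) ⟩
    (- + fib (2 ℕ.+ k) , + fib (4 ℕ.+ k))                         ∎
    where open ≡-Reasoning

  ε-coefficient : ∀ k → proj₂ (ε k) ≡ + fib (ℕ.suc k)
  ε-coefficient 0 = refl
  ε-coefficient (ℕ.suc k) = cong proj₂ (ε-suc k)

  frac-fib-odd : ∀ m → frac (fib (2 ℕ.+ 2 ℕ.* m)) ≡ ε (1 ℕ.+ 2 ℕ.* m)
  frac-fib-odd m = trans (cong (λ n → - + n , + fib (2 ℕ.+ 2 ℕ.* m)) (floorγ-fib-even m)) (sym (ε-suc (2 ℕ.* m)))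

  frac-fib-even : ∀ m → frac (fib (1 ℕ.+ 2 ℕ.* m)) ≡ 𝟙 ⊕ ε (2 ℕ.* m)
  frac-fib-even 0       = refl
  frac-fib-even (ℕ.suc m) = subst (λ k → frac (fib (1 ℕ.+ k)) ≡ 𝟙 ⊕ ε k) (sym (ℕ.*-suc 2 m)) (begin
    frac (fib (3 ℕ.+ 2 ℕ.* m))
      ≡⟨ cong (λ n → n , + fib (3 ℕ.+ 2 ℕ.* m)) (lower (+ floorγ (fib (3 ℕ.+ 2 ℕ.* m)))) ⟩
    (1ℤ + - (1ℤ + + floorγ (fib (3 ℕ.+ 2 ℕ.* m))) , + fib (3 ℕ.+ 2 ℕ.* m))
      ≡⟨ cong (λ n → 1ℤ + - + n , + fib (3 ℕ.+ 2 ℕ.* m)) (floorγ-fib-odd m) ⟩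
    𝟙 ⊕ (- + fib (1 ℕ.+ 2 ℕ.* m) , + fib (3 ℕ.+ 2 ℕ.* m))    ≡⟨ cong (𝟙 ⊕_) (sym (ε-suc (1 ℕ.+ 2 ℕ.* m))) ⟩
    𝟙 ⊕ ε (2 ℕ.+ 2 ℕ.* m)                                    ∎)
    where
    open ≡-Reasoning
    lower : ∀ g → - g ≡ 1ℤ + - (1ℤ + g)
    lower = solve-∀

  ε-odd-nonneg : ∀ m → 𝟘 ≤γ ε (1 ℕ.+ 2 ℕ.* m)
  ε-odd-nonneg m = subst (𝟘 ≤γ_) (frac-fib-odd m) (𝟘≤frac _)

  ε-even-neg : ∀ m → ε (2 ℕ.* m) <γ 𝟘
  ε-even-neg m 𝟘≤ε = frac<𝟙 (fib (1 ℕ.+ 2 ℕ.* m))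
    (subst (𝟙 ≤γ_) (sym (frac-fib-even m)) (⊕-mono-≤γ (≤γ-refl {𝟙}) 𝟘≤ε))

  ε-even-step : ∀ m → ε (2 ℕ.* ℕ.suc m) ≡ ε (2 ℕ.* m) ⊕ ε (1 ℕ.+ 2 ℕ.* m)
  ε-even-step m = cong ε (ℕ.*-suc 2 m)

  ε-odd-step : ∀ m → ε (1 ℕ.+ 2 ℕ.* ℕ.suc m) ≡ ε (1 ℕ.+ 2 ℕ.* m) ⊕ ε (2 ℕ.* ℕ.suc m)
  ε-odd-step m = subst (λ k → ε (1 ℕ.+ k) ≡ ε (1 ℕ.+ 2 ℕ.* m) ⊕ ε k) (sym (ℕ.*-suc 2 m)) refl

  ⊖ε-even-antitone : ∀ m → ⊖ ε (2 ℕ.* ℕ.suc m) ≤γ ⊖ ε (2 ℕ.* m)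
  ⊖ε-even-antitone m = subst (λ e → ⊖ e ≤γ ⊖ ε (2 ℕ.* m)) (sym (ε-even-step m)) (nonneg-diff
    (subst NonNeg (cong₂ _,_ (shrink (proj₁ a) (proj₁ b)) (shrink (proj₂ a) (proj₂ b))) (𝟘≤γ⇒NonNeg (ε-odd-nonneg m))))
    where
    a = ε (2 ℕ.* m)
    b = ε (1 ℕ.+ 2 ℕ.* m)
    shrink : ∀ a b → b ≡ - a - - (a + b)
    shrink = solve-∀

  ⊖ε-even≤𝟙 : ∀ m → ⊖ ε (2 ℕ.* m) ≤γ 𝟙
  ⊖ε-even≤𝟙 m = subst (_≤γ 𝟙) (cong₂ _,_ (+-identityˡ _) (+-identityˡ _))
    (≤γ-⊕⇒⊝-≤γ (ε (2 ℕ.* m)) (subst (𝟘 ≤γ_) (frac-fib-even m) (𝟘≤frac _)))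

  -- This is |ε(2m)| = ε(2m+1) + |ε(2m+2)|, which follows from ε(2m+2) = ε(2m) + ε(2m+1).
  ε-odd-⊕-below : ∀ m {σ} → σ <γ ⊖ ε (2 ℕ.* ℕ.suc m) → ε (1 ℕ.+ 2 ℕ.* m) ⊕ σ <γ ⊖ ε (2 ℕ.* m)
  ε-odd-⊕-below m {σ} σ<bound = subst (ε (1 ℕ.+ 2 ℕ.* m) ⊕ σ <γ_)
    (trans (cong (λ e → b ⊕ ⊖ e) (ε-even-step m)) (cong₂ _,_ (absorb (proj₁ a) (proj₁ b)) (absorb (proj₂ a) (proj₂ b))))
    (⊕-monoʳ-<γ b σ<bound)
    where
    a = ε (2 ℕ.* m)
    b = ε (1 ℕ.+ 2 ℕ.* m)
    absorb : ∀ a b → b + - (a + b) ≡ - a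
    absorb = solve-∀

  span : ∀ k δ → ∃₂ λ u v → δ ≡ u · ε k ⊕ v · ε (ℕ.suc k)
  span 0 (e , d) = - e , d + e , cong₂ _,_ (first e d) (second e d)
    where
    first : ∀ e d → e ≡ - e * -1ℤ + (d + e) * 0ℤ
    first = solve-∀
    second : ∀ e d → d ≡ - e * 1ℤ + (d + e) * 1ℤ
    second = solve-∀
  span (ℕ.suc k) δ with span k δ
  ... | u , v , δ≡ = v - u , u , trans δ≡ (cong₂ _,_ (rebase u v (proj₁ (ε k)) (proj₁ (ε (ℕ.suc k))))
                                                      (rebase u v (proj₂ (ε k)) (proj₂ (ε (ℕ.suc k)))))
    where
    rebase : ∀ u v a b → u * a + v * b ≡ (v - u) * b + u * (a + b)
    rebase = solve-∀

  data OppositeSigns : ℤ → ℤ → Set where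
    pos-nonpos : ∀ U V → OppositeSigns (+ ℕ.suc U) (- + V)
    neg-nonneg : ∀ U V → OppositeSigns -[1+ U ] (+ V)

  OppositeSigns-neg : ∀ {u v} → OppositeSigns u v → OppositeSigns (- u) (- v)
  OppositeSigns-neg (pos-nonpos U V) = subst (OppositeSigns -[1+ U ]) (sym (neg-involutive (+ V))) (neg-nonneg U V)
  OppositeSigns-neg (neg-nonneg U V) = pos-nonpos U V

  private
    nonpos≢pos : ∀ X {D} → 0 ℕ.< D → - + X ≢ + D
    nonpos≢pos ℕ.zero    0<D eq = ℕ.<-irrefl (+-injective eq) 0<D
    nonpos≢pos (ℕ.suc X) 0<D ()

    negative-multiple : ∀ U A → -[1+ U ] * + A ≡ - + (ℕ.suc U ℕ.* A)
    negative-multiple U A = trans (sym (neg-distribˡ-* (+ ℕ.suc U) (+ A))) (cong -_ (sym (pos-* (ℕ.suc U) A)))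

    B≤multiple : ∀ X V B → B ℕ.≤ X ℕ.+ ℕ.suc V ℕ.* B
    B≤multiple X V B = ℕ.≤-trans (ℕ.m≤m+n B (V ℕ.* B)) (ℕ.m≤n+m _ X)

  opposite-signs : ∀ u v {A B D} → u * + A + v * + B ≡ + D → 0 ℕ.< D → D ℕ.< B → OppositeSigns u v
  opposite-signs (+ ℕ.suc U) (+ ℕ.suc V) {A} {B} eq _ D<B =
    contradiction (subst (B ℕ.≤_) (+-injective (trans (cong₂ _+_ (pos-* (ℕ.suc U) A) (pos-* (ℕ.suc V) B)) eq))
                    (B≤multiple (ℕ.suc U ℕ.* A) V B)) (ℕ.<⇒≱ D<B)
  opposite-signs (+ ℕ.suc U) (+ ℕ.zero) _ _ _ = pos-nonpos U 0
  opposite-signs (+ ℕ.suc U) -[1+ V ]   _ _ _ = pos-nonpos U (ℕ.suc V)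
  opposite-signs (+ ℕ.zero) (+ ℕ.zero) eq 0<D _ = contradiction 0<D (ℕ.<-irrefl (+-injective eq))
  opposite-signs (+ ℕ.zero) (+ ℕ.suc V) {B = B} eq _ D<B =
    contradiction (subst (B ℕ.≤_) (+-injective (trans (pos-* (ℕ.suc V) B) (trans (sym (+-identityˡ _)) eq)))
                    (B≤multiple 0 V B)) (ℕ.<⇒≱ D<B)
  opposite-signs (+ ℕ.zero) -[1+ V ] {B = B} eq 0<D _ = ⊥-elim $
    nonpos≢pos (ℕ.suc V ℕ.* B) 0<D (trans (sym (negative-multiple V B)) (trans (sym (+-identityˡ _)) eq))
  opposite-signs -[1+ U ] (+ V) _ _ _ = neg-nonneg U V
  opposite-signs -[1+ U ] -[1+ V ] {A} {B} eq 0<D _ = ⊥-elim $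
    nonpos≢pos (ℕ.suc U ℕ.* A ℕ.+ ℕ.suc V ℕ.* B) 0<D (trans (neg-distrib-+ (+ (ℕ.suc U ℕ.* A)) (+ (ℕ.suc V ℕ.* B)))
      (trans (sym (cong₂ _+_ (negative-multiple U A) (negative-multiple V B))) eq))

  Far : ℤ[γ] → ℤ[γ] → Set
  Far r δ = r ≤γ δ ⊎ r ≤γ ⊖ δ

  far-from-basis : ∀ {a b u v} → 𝟘 ≤γ a → b ≤γ 𝟘 → OppositeSigns u v → Far a (u · a ⊕ v · b)
  far-from-basis {a₁ , a₂} {b₁ , b₂} 𝟘≤a b≤𝟘 (pos-nonpos U V) = inj₁ (nonneg-diff (subst NonNeg
    (cong₂ _,_ (rearrange (+ U) (+ V) a₁ b₁) (rearrange (+ U) (+ V) a₂ b₂))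
    (𝟘≤γ⇒NonNeg (⊕-mono-≤γ (𝟘≤γ-scale U 𝟘≤a) (𝟘≤γ-scale V (NonNeg⇒𝟘≤γ (≤γ𝟘⇒NonNeg b≤𝟘)))))))
    where
    rearrange : ∀ U V a b → U * a + V * - b ≡ (1ℤ + U) * a + - V * b - a
    rearrange = solve-∀
  far-from-basis {a₁ , a₂} {b₁ , b₂} 𝟘≤a b≤𝟘 (neg-nonneg U V) = inj₂ (nonneg-diff (subst NonNeg
    (cong₂ _,_ (rearrange (+ U) (+ V) a₁ b₁) (rearrange (+ U) (+ V) a₂ b₂))
    (𝟘≤γ⇒NonNeg (⊕-mono-≤γ (𝟘≤γ-scale U 𝟘≤a) (𝟘≤γ-scale V (NonNeg⇒𝟘≤γ (≤γ𝟘⇒NonNeg b≤𝟘)))))))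
    where
    rearrange : ∀ U V a b → U * a + V * - b ≡ - (- (1ℤ + U) * a + V * b) - a
    rearrange = solve-∀

  -- Best approximation: |Dγ − e| ≥ |ε k| whenever 0 < D < F(k+2).
  ε-best-odd : ∀ m δ {D} → proj₂ δ ≡ + D → 0 ℕ.< D → D ℕ.< fib (3 ℕ.+ 2 ℕ.* m) → Far (ε (1 ℕ.+ 2 ℕ.* m)) δ
  ε-best-odd m δ δ₂≡D 0<D D<F with span (1 ℕ.+ 2 ℕ.* m) δ
  ... | u , v , refl = far-from-basis (ε-odd-nonneg m) (<γ⇒≤γ ε₊<𝟘) (opposite-signs u v
    (trans (cong₂ (λ p q → u * p + v * q) (sym (ε-coefficient (1 ℕ.+ 2 ℕ.* m))) (sym (ε-coefficient (2 ℕ.+ 2 ℕ.* m)))) δ₂≡D) 0<D D<F)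
    where
    ε₊<𝟘 : ε (2 ℕ.+ 2 ℕ.* m) <γ 𝟘
    ε₊<𝟘 = subst (λ i → ε i <γ 𝟘) (ℕ.*-suc 2 m) (ε-even-neg (ℕ.suc m))

  ε-best-even : ∀ m δ {D} → proj₂ δ ≡ + D → 0 ℕ.< D → D ℕ.< fib (2 ℕ.+ 2 ℕ.* m) → Far (⊖ ε (2 ℕ.* m)) δ
  ε-best-even m δ δ₂≡D 0<D D<F with span (2 ℕ.* m) δ
  ... | u , v , refl = subst (Far (⊖ ε (2 ℕ.* m)))
    (cong₂ _,_ (negate-both u v (proj₁ (ε (2 ℕ.* m))) (proj₁ (ε (1 ℕ.+ 2 ℕ.* m))))
               (negate-both u v (proj₂ (ε (2 ℕ.* m))) (proj₂ (ε (1 ℕ.+ 2 ℕ.* m)))))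
    (far-from-basis (≤γ𝟘⇒𝟘≤γ⊖ (<γ⇒≤γ (ε-even-neg m))) (𝟘≤γ⇒⊖≤γ𝟘 (ε-odd-nonneg m))
      (OppositeSigns-neg (opposite-signs u v
        (trans (cong₂ (λ p q → u * p + v * q) (sym (ε-coefficient (2 ℕ.* m))) (sym (ε-coefficient (1 ℕ.+ 2 ℕ.* m)))) δ₂≡D) 0<D D<F)))
    where
    negate-both : ∀ u v a b → - u * - a + - v * - b ≡ u * a + v * b
    negate-both = solve-∀

  interval-gap : ∀ {lo r x y} → lo ≤γ x → x <γ lo ⊕ r → lo ≤γ y → y <γ lo ⊕ r → ¬ Far r (y ⊝ x)
  interval-gap {lo} {r} {x₁ , x₂} {y₁ , y₂} lo≤x x<hi lo≤y y<hi (inj₁ r≤y-x) =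
    y<hi (subst (lo ⊕ r ≤γ_) (cong₂ _,_ (forward x₁ y₁) (forward x₂ y₂)) (⊕-mono-≤γ lo≤x r≤y-x))
    where
    forward : ∀ x y → x + (y - x) ≡ y
    forward = solve-∀
  interval-gap {lo} {r} {x₁ , x₂} {y₁ , y₂} lo≤x x<hi lo≤y y<hi (inj₂ r≤x-y) =
    x<hi (subst (lo ⊕ r ≤γ_) (cong₂ _,_ (backward x₁ y₁) (backward x₂ y₂)) (⊕-mono-≤γ lo≤y r≤x-y))
    where
    backward : ∀ x y → y + - (y - x) ≡ x
    backward = solve-∀

  frac-difference : ∀ z D → proj₂ (frac (z ℕ.+ D) ⊝ frac z) ≡ + D
  frac-difference z D = cancel (+ z) (+ D)
    where
    cancel : ∀ z D → z + D - z ≡ D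
    cancel = solve-∀

  -- Adding F(2m+2), whose fractional part is ε(2m+1), carries iff {zγ} ∈ [1 − ε(2m+1), 1), and adding
  -- F(2m+1), whose fractional part is 1 + ε(2m), does not carry iff {zγ} ∈ [0, −ε(2m)). Two such z are
  -- closer on the circle than the interval length, so best approximation keeps them F(2m+3) resp. F(2m+2) apart.
  carry-sparse-odd : ∀ m z D → 0 ℕ.< D → D ℕ.< fib (3 ℕ.+ 2 ℕ.* m) →
                     carry z (fib (2 ℕ.+ 2 ℕ.* m)) ≡ 1 → ¬ carry (z ℕ.+ D) (fib (2 ℕ.+ 2 ℕ.* m)) ≡ 1
  carry-sparse-odd m z D 0<D D<F c₁ c₂ = interval-gap (above z c₁) (frac<1 z) (above (z ℕ.+ D) c₂) (frac<1 (z ℕ.+ D))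
    (ε-best-odd m (frac (z ℕ.+ D) ⊝ frac z) (frac-difference z D) 0<D D<F)
    where
    εₖ = ε (1 ℕ.+ 2 ℕ.* m)
    above : ∀ x → carry x (fib (2 ℕ.+ 2 ℕ.* m)) ≡ 1 → 𝟙 ⊝ εₖ ≤γ frac x
    above x c = ≤γ-⊕⇒⊝-≤γ εₖ (subst (λ f → 𝟙 ≤γ frac x ⊕ f) (frac-fib-odd m) (carry≡1⇒𝟙≤ x _ c))
    frac<1 : ∀ x → frac x <γ 𝟙 ⊝ εₖ ⊕ εₖ
    frac<1 x = subst (frac x <γ_) (cong₂ _,_ (restore 1ℤ (proj₁ εₖ)) (restore 0ℤ (proj₂ εₖ))) (frac<𝟙 x)
      where
      restore : ∀ o e → o ≡ o - e + e
      restore = solve-∀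

  carry-sparse-even : ∀ m z D → 0 ℕ.< D → D ℕ.< fib (2 ℕ.+ 2 ℕ.* m) →
                      carry z (fib (1 ℕ.+ 2 ℕ.* m)) ≡ 0 → ¬ carry (z ℕ.+ D) (fib (1 ℕ.+ 2 ℕ.* m)) ≡ 0
  carry-sparse-even m z D 0<D D<F c₁ c₂ = interval-gap (𝟘≤frac z) (under z c₁) (𝟘≤frac (z ℕ.+ D)) (under (z ℕ.+ D) c₂)
    (ε-best-even m (frac (z ℕ.+ D) ⊝ frac z) (frac-difference z D) 0<D D<F)
    where
    εₖ = ε (2 ℕ.* m)
    under : ∀ x → carry x (fib (1 ℕ.+ 2 ℕ.* m)) ≡ 0 → frac x <γ 𝟘 ⊕ ⊖ εₖ
    under x c = subst (frac x <γ_) (cong₂ _,_ (drop 1ℤ (proj₁ εₖ)) (drop 0ℤ (proj₂ εₖ)))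
      (⊕-<γ⇒<γ-⊝ (𝟙 ⊕ εₖ) (subst (λ f → frac x ⊕ f <γ 𝟙) (frac-fib-even m) (carry≡0⇒<𝟙 x _ c)))
      where
      drop : ∀ o e → o - (o + e) ≡ 0ℤ + - e
      drop = solve-∀

  fibTail : ℕ → ℕ → ℕ
  fibTail m 0         = 0
  fibTail m (ℕ.suc r) = fib (2 ℕ.+ 2 ℕ.* m) ℕ.+ fibTail (3 ℕ.+ m) r

  εTail : ℕ → ℕ → ℤ[γ]
  εTail m 0         = 𝟘
  εTail m (ℕ.suc r) = ε (1 ℕ.+ 2 ℕ.* m) ⊕ εTail (3 ℕ.+ m) r

  εTail-nonneg : ∀ m r → 𝟘 ≤γ εTail m r
  εTail-nonneg m 0         = ≤γ-refl
  εTail-nonneg m (ℕ.suc r) = ⊕-mono-≤γ (ε-odd-nonneg m) (εTail-nonneg (3 ℕ.+ m) r)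

  εTail-bound         : ∀ m r → εTail m r <γ ⊖ ε (2 ℕ.* m)
  εTail-shifted-bound : ∀ m r → εTail (3 ℕ.+ m) r <γ ⊖ ε (2 ℕ.* ℕ.suc m)

  εTail-bound m 0         = <γ𝟘⇒𝟘<γ⊖ (ε-even-neg m)
  εTail-bound m (ℕ.suc r) = ε-odd-⊕-below m (εTail-shifted-bound m r)
  εTail-shifted-bound m r = <γ-≤γ-trans (εTail-bound (3 ℕ.+ m) r)
    (≤γ-trans (⊖ε-even-antitone (2 ℕ.+ m)) (⊖ε-even-antitone (1 ℕ.+ m)))

  frac-fibTail : ∀ m r → frac (fibTail m r) ≡ εTail m r
  frac-fibTail m 0         = refl
  frac-fibTail m (ℕ.suc r) = trans (frac-+ (fib (2 ℕ.+ 2 ℕ.* m)) (fibTail (3 ℕ.+ m) r)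
    (subst (_<γ 𝟙) (sym split) (<γ-≤γ-trans (εTail-bound m (ℕ.suc r)) (⊖ε-even≤𝟙 m)))) split
    where
    split : frac (fib (2 ℕ.+ 2 ℕ.* m)) ⊕ frac (fibTail (3 ℕ.+ m) r) ≡ εTail m (ℕ.suc r)
    split = cong₂ _⊕_ (frac-fib-odd m) (frac-fibTail (3 ℕ.+ m) r)

  private
    even-special-bound : ∀ m r → ε (1 ℕ.+ 2 ℕ.* m) ⊕ εTail (1 ℕ.+ m) r <γ ⊖ ε (2 ℕ.* m)
    even-special-bound m r = ε-odd-⊕-below m (εTail-bound (1 ℕ.+ m) r)

    frac-even-special : ∀ m r → frac (fib (2 ℕ.+ 2 ℕ.* m) ℕ.+ fibTail (1 ℕ.+ m) r) ≡ ε (1 ℕ.+ 2 ℕ.* m) ⊕ εTail (1 ℕ.+ m) r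
    frac-even-special m r = trans (frac-+ (fib (2 ℕ.+ 2 ℕ.* m)) (fibTail (1 ℕ.+ m) r)
      (subst (_<γ 𝟙) (sym split) (<γ-≤γ-trans (even-special-bound m r) (⊖ε-even≤𝟙 m)))) split
      where
      split = cong₂ _⊕_ (frac-fib-odd m) (frac-fibTail (1 ℕ.+ m) r)

    frac-odd-special : ∀ m r → frac (fib (3 ℕ.+ 2 ℕ.* m) ℕ.+ fibTail (3 ℕ.+ m) r) ≡ 𝟙 ⊕ ε (2 ℕ.* ℕ.suc m) ⊕ εTail (3 ℕ.+ m) r
    frac-odd-special m r = trans (frac-+ (fib (3 ℕ.+ 2 ℕ.* m)) (fibTail (3 ℕ.+ m) r) (subst (_<γ 𝟙) (sym split) no-overflow)) split
      where
      a = ε (2 ℕ.* ℕ.suc m)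
      vanish : ∀ o a → o + a + - a ≡ o
      vanish = solve-∀
      no-overflow : 𝟙 ⊕ a ⊕ εTail (3 ℕ.+ m) r <γ 𝟙
      no-overflow = subst (𝟙 ⊕ a ⊕ εTail (3 ℕ.+ m) r <γ_) (cong₂ _,_ (vanish 1ℤ (proj₁ a)) (vanish 0ℤ (proj₂ a)))
        (⊕-monoʳ-<γ (𝟙 ⊕ a) (εTail-shifted-bound m r))
      frac-head : frac (fib (3 ℕ.+ 2 ℕ.* m)) ≡ 𝟙 ⊕ a
      frac-head = subst (λ k → frac (fib (1 ℕ.+ k)) ≡ 𝟙 ⊕ a) (ℕ.*-suc 2 m) (frac-fib-even (ℕ.suc m))
      split = cong₂ _⊕_ frac-head (frac-fibTail (3 ℕ.+ m) r)

  -- F(2m+2) and F(2m+3) lie in these exceptional intervals, and adding a tail, whose fractional part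
  -- is nonnegative and below |ε(2m+2)|, keeps them there.
  special-even : ∀ m r → carry (fib (2 ℕ.+ 2 ℕ.* m) ℕ.+ fibTail (1 ℕ.+ m) r) (fib (1 ℕ.+ 2 ℕ.* m)) ≡ 0
  special-even m r = <𝟙⇒carry≡0 (fib (2 ℕ.+ 2 ℕ.* m) ℕ.+ fibTail (1 ℕ.+ m) r) (fib (1 ℕ.+ 2 ℕ.* m))
    (subst₂ (λ f g → f ⊕ g <γ 𝟙) (sym (frac-even-special m r)) (sym (frac-fib-even m))
      (subst (ε (1 ℕ.+ 2 ℕ.* m) ⊕ εTail (1 ℕ.+ m) r ⊕ (𝟙 ⊕ a) <γ_) (cong₂ _,_ (cancel 1ℤ (proj₁ a)) (cancel 0ℤ (proj₂ a)))
        (⊕-monoˡ-<γ (𝟙 ⊕ a) (even-special-bound m r))))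
    where
    a = ε (2 ℕ.* m)
    cancel : ∀ o e → - e + (o + e) ≡ o
    cancel = solve-∀

  special-odd : ∀ m r → carry (fib (3 ℕ.+ 2 ℕ.* m) ℕ.+ fibTail (3 ℕ.+ m) r) (fib (2 ℕ.+ 2 ℕ.* m)) ≡ 1
  special-odd m r = 𝟙≤⇒carry≡1 (fib (3 ℕ.+ 2 ℕ.* m) ℕ.+ fibTail (3 ℕ.+ m) r) (fib (2 ℕ.+ 2 ℕ.* m))
    (subst₂ (λ f g → 𝟙 ≤γ f ⊕ g) (sym (frac-odd-special m r)) (sym (frac-fib-odd m)) (begin
      𝟙                                 ≤⟨ ⊕-mono-≤γ (≤γ-refl {𝟙}) (⊕-mono-≤γ (ε-odd-nonneg (ℕ.suc m)) (εTail-nonneg (3 ℕ.+ m) r)) ⟩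
      𝟙 ⊕ (ε (1 ℕ.+ 2 ℕ.* ℕ.suc m) ⊕ σ) ≡⟨ cong (λ e → 𝟙 ⊕ (e ⊕ σ)) (ε-odd-step m) ⟩
      𝟙 ⊕ (b ⊕ a ⊕ σ)                   ≡⟨ cong₂ _,_ (regroup 1ℤ (proj₁ a) (proj₁ b) (proj₁ σ)) (regroup 0ℤ (proj₂ a) (proj₂ b) (proj₂ σ)) ⟩
      𝟙 ⊕ a ⊕ σ ⊕ b                     ∎))
    where
    open ≤γ-Reasoning
    a = ε (2 ℕ.* ℕ.suc m)
    b = ε (1 ℕ.+ 2 ℕ.* m)
    σ = εTail (3 ℕ.+ m) r
    regroup : ∀ o a b s → o + (b + a + s) ≡ o + a + s + b
    regroup = solve-∀

open FractionalParts using (carry-sparse-odd; carry-sparse-even; fibTail; special-even; special-odd)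

open import Data.Nat
open import Data.Nat.Properties
open import Data.Nat.DivMod using (m*n/n≡m)
open import Data.Nat.Tactic.RingSolver using (solve-∀)
open import Data.List using (List; length; applyUpTo)
open import Data.List.Properties using (length-removeAt′; length-applyUpTo)
open import Data.List.Relation.Unary.All as All using (All; []; _∷_)
import Data.List.Relation.Unary.All.Properties as All
open import Data.List.Relation.Unary.AllPairs using ([]; _∷_)
open import Data.List.Relation.Unary.Any as Any using (here; there)
open import Data.List.Relation.Unary.Unique.Propositional using (Unique)
import Data.List.Relation.Unary.Unique.Propositional.Properties as Unique
open import Data.List.Membership.Propositional using (_∈_; _─_)
open import Data.List.Membership.Propositional.Properties using (∈-applyUpTo⁺)

Σ<-cong : ∀ n {f g : ℕ → ℕ} → (∀ k → f k ≡ g k) → Σ< n f ≡ Σ< n g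
Σ<-cong zero    f≡g = refl
Σ<-cong (suc n) f≡g = cong₂ _+_ (Σ<-cong n f≡g) (f≡g n)

Σ<-+ : ∀ n (f g : ℕ → ℕ) → Σ< n (λ k → f k + g k) ≡ Σ< n f + Σ< n g
Σ<-+ zero    f g = refl
Σ<-+ (suc n) f g = trans (cong (_+ (f n + g n)) (Σ<-+ n f g)) (interchange (Σ< n f) (Σ< n g) (f n) (g n))
  where
  interchange : ∀ a b c d → a + b + (c + d) ≡ a + c + (b + d)
  interchange = solve-∀

Σ<-const : ∀ n c → Σ< n (λ _ → c) ≡ n * c
Σ<-const zero    c = refl
Σ<-const (suc n) c = trans (cong (_+ c) (Σ<-const n c)) (+-comm (n * c) c)

Σ<-split : ∀ a b (f : ℕ → ℕ) → Σ< (a + b) f ≡ Σ< a f + Σ< b (λ k → f (a + k))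
Σ<-split a zero    f = trans (cong (λ n → Σ< n f) (+-identityʳ a)) (sym (+-identityʳ _))
Σ<-split a (suc b) f = begin
  Σ< (a + suc b) f                              ≡⟨ cong (λ n → Σ< n f) (+-suc a b) ⟩
  Σ< (a + b) f + f (a + b)                      ≡⟨ cong (_+ f (a + b)) (Σ<-split a b f) ⟩
  Σ< a f + Σ< b (λ k → f (a + k)) + f (a + b)   ≡⟨ +-assoc (Σ< a f) _ _ ⟩
  Σ< a f + (Σ< b (λ k → f (a + k)) + f (a + b)) ∎
  where open ≡-Reasoning

Σ<-swap : ∀ m n (f : ℕ → ℕ → ℕ) → Σ< m (λ i → Σ< n (f i)) ≡ Σ< n (λ j → Σ< m (λ i → f i j))
Σ<-swap zero    n f = sym (trans (Σ<-const n 0) (*-zeroʳ n))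
Σ<-swap (suc m) n f = trans (cong (_+ Σ< n (f m)) (Σ<-swap m n f)) (sym (Σ<-+ n (λ j → Σ< m (λ i → f i j)) (f m)))

Σ<-shift : ∀ n (f : ℕ → ℕ) → Σ< n (λ k → f (suc k)) + f 0 ≡ Σ< n f + f n
Σ<-shift zero    f = refl
Σ<-shift (suc n) f = trans (rotate (Σ< n (λ k → f (suc k))) (f (suc n)) (f 0)) (cong (_+ f (suc n)) (Σ<-shift n f))
  where
  rotate : ∀ a b c → a + b + c ≡ a + c + b
  rotate = solve-∀

Σ<-mono-≤ : ∀ n {f g : ℕ → ℕ} → (∀ k → f k ≤ g k) → Σ< n f ≤ Σ< n g
Σ<-mono-≤ zero    f≤g = z≤n
Σ<-mono-≤ (suc n) f≤g = +-mono-≤ (Σ<-mono-≤ n f≤g) (f≤g n)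

term≤Σ< : ∀ n (f : ℕ → ℕ) {a} → a < n → f a ≤ Σ< n f
term≤Σ< (suc n) f {a} a<1+n with m≤n⇒m<n∨m≡n (≤-pred a<1+n)
... | inj₁ a<n  = ≤-trans (term≤Σ< n f a<n) (m≤m+n _ _)
... | inj₂ refl = m≤n+m _ _

Σ<-positive : ∀ n (f : ℕ → ℕ) → 0 < Σ< n f → ∃ λ a → a < n × 0 < f a
Σ<-positive (suc n) f 0<Σ with f n ≟ 0
... | no  fn≢0 = n , ≤-refl , n≢0⇒n>0 fn≢0
... | yes fn≡0 with Σ<-positive n f (subst (0 <_) (trans (cong (Σ< n f +_) fn≡0) (+-identityʳ _)) 0<Σ)
...   | a , a<n , 0<fa = a , m≤n⇒m≤1+n a<n , 0<fa

-- Factors of the Fibonacci word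

fibWord-telescope : ∀ j → fibWord j + floorγ (suc j) ≡ floorγ (suc (suc j))
fibWord-telescope j = begin
  floorγ (j + 2) ∸ floorγ (j + 1) + floorγ (suc j)
    ≡⟨ cong₂ (λ a b → floorγ a ∸ floorγ b + floorγ (suc j)) (+-comm j 2) (+-comm j 1) ⟩
  floorγ (suc (suc j)) ∸ floorγ (suc j) + floorγ (suc j)
    ≡⟨ m∸n+n≡m (≤-trans (m≤n+m _ (floorγ 1)) (floorγ-superadditive 1 (suc j))) ⟩
  floorγ (suc (suc j)) ∎
  where open ≡-Reasoning

ones : ℕ → ℕ → ℕ
ones y L = Σ< L (λ l → fibWord (y + l))

ones-telescope : ∀ y L → ones y L + floorγ (suc y) ≡ floorγ (suc y + L)
ones-telescope y zero    = cong floorγ (sym (+-identityʳ (suc y)))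
ones-telescope y (suc L) = begin
  ones y L + fibWord (y + L) + floorγ (suc y)   ≡⟨ rotate (ones y L) (fibWord (y + L)) (floorγ (suc y)) ⟩
  ones y L + floorγ (suc y) + fibWord (y + L)   ≡⟨ cong (_+ fibWord (y + L)) (ones-telescope y L) ⟩
  floorγ (suc (y + L)) + fibWord (y + L)        ≡⟨ +-comm (floorγ (suc (y + L))) (fibWord (y + L)) ⟩
  fibWord (y + L) + floorγ (suc (y + L))        ≡⟨ fibWord-telescope (y + L) ⟩
  floorγ (suc (suc (y + L)))                    ≡⟨ cong (λ n → floorγ (suc n)) (+-suc y L) ⟨
  floorγ (suc y + suc L)                        ∎
  where
  open ≡-Reasoning
  rotate : ∀ a b c → a + b + c ≡ a + c + b
  rotate = solve-∀

ones-carry : ∀ y L → ones y L ≡ floorγ L + carry (suc y) L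
ones-carry y L = +-cancelʳ-≡ (floorγ (suc y)) _ _ (begin
  ones y L + floorγ (suc y)                    ≡⟨ ones-telescope y L ⟩
  floorγ (suc y + L)                           ≡⟨ floorγ-+ (suc y) L ⟩
  floorγ (suc y) + floorγ L + carry (suc y) L  ≡⟨ rotate (floorγ (suc y)) (floorγ L) (carry (suc y) L) ⟩
  floorγ L + carry (suc y) L + floorγ (suc y)  ∎)
  where
  open ≡-Reasoning
  rotate : ∀ a b c → a + b + c ≡ b + c + a
  rotate = solve-∀

ones-split : ∀ y m L → ones y (m + L) ≡ ones y m + ones (y + m) L
ones-split y m L = trans (Σ<-split m L (λ l → fibWord (y + l)))
  (cong (ones y m +_) (Σ<-cong L (λ k → cong fibWord (sym (+-assoc y m k)))))

T-swap : ∀ x a b → T x a b ≡ T x b a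
T-swap x a b = trans (Σ<-swap a b (λ k l → fibWord (x + k + l)))
  (Σ<-cong b (λ l → Σ<-cong a (λ k → cong fibWord (swap-last x k l))))
  where
  swap-last : ∀ x k l → x + k + l ≡ x + l + k
  swap-last = solve-∀

T-split : ∀ i m L → T i (m + L) (m + L) ≡ T i m m + T (i + m) m L + T (i + m) (m + L) L
T-split i m L = begin
  T i (m + L) (m + L)
    ≡⟨ Σ<-cong (m + L) (λ k → ones-split (i + k) m L) ⟩
  Σ< (m + L) (λ k → ones (i + k) m + ones (i + k + m) L)
    ≡⟨ Σ<-+ (m + L) (λ k → ones (i + k) m) (λ k → ones (i + k + m) L) ⟩
  T i (m + L) m + Σ< (m + L) (λ k → ones (i + k + m) L)
    ≡⟨ cong₂ _+_ (Σ<-split m L (λ k → ones (i + k) m)) (Σ<-cong (m + L) (λ k → cong (λ y → ones y L) (shift i k m))) ⟩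
  T i m m + Σ< L (λ k → ones (i + (m + k)) m) + T (i + m) (m + L) L
    ≡⟨ cong (λ t → T i m m + t + T (i + m) (m + L) L)
         (trans (Σ<-cong L (λ k → cong (λ y → ones y m) (sym (+-assoc i m k)))) (T-swap (i + m) L m)) ⟩
  T i m m + T (i + m) m L + T (i + m) (m + L) L ∎
  where
  open ≡-Reasoning
  shift : ∀ i k m → i + k + m ≡ i + m + k
  shift = solve-∀

T-step : ∀ i m → T (suc i) m m + ones i m ≡ T i m m + ones (i + m) m
T-step i m = trans (cong₂ _+_ (Σ<-cong m (λ k → cong (λ y → ones y m) (sym (+-suc i k))))
                              (cong (λ y → ones y m) (sym (+-identityʳ i))))
                   (Σ<-shift m (λ k → ones (i + k) m))

T-walk : ∀ m i → T (suc i) m m ≤ suc (T i m m)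
T-walk m i = +-cancelʳ-≤ (floorγ m) _ _ (begin
  T (suc i) m m + floorγ m                ≤⟨ +-monoʳ-≤ (T (suc i) m m) (subst (floorγ m ≤_) (sym (ones-carry i m)) (m≤m+n _ _)) ⟩
  T (suc i) m m + ones i m                ≡⟨ T-step i m ⟩
  T i m m + ones (i + m) m                ≤⟨ +-monoʳ-≤ (T i m m) (subst (_≤ floorγ m + 1) (sym (ones-carry (i + m) m))
                                               (+-monoʳ-≤ (floorγ m) (carry≤1 (suc (i + m)) m))) ⟩
  T i m m + (floorγ m + 1)                ≡⟨ rearrange (T i m m) (floorγ m) ⟩
  suc (T i m m) + floorγ m                ∎)
  where
  open ≤-Reasoning
  rearrange : ∀ t g → t + (g + 1) ≡ suc t + g
  rearrange = solve-∀

-- The square as a sum of layers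

private
  blocks : ℕ → ℕ
  blocks j = Σ< j (λ i → fib (1 + 3 * i))

  fib-3*-blocks : ∀ j → fib (3 * j) ≡ blocks j * 2
  fib-3*-blocks zero    = refl
  fib-3*-blocks (suc j) = begin
    fib (3 * suc j)                                  ≡⟨ cong fib (*-suc 3 j) ⟩
    fib (1 + 3 * j) + fib (3 * j) + fib (1 + 3 * j)  ≡⟨ cong (λ t → fib (1 + 3 * j) + t + fib (1 + 3 * j)) (fib-3*-blocks j) ⟩
    fib (1 + 3 * j) + blocks j * 2 + fib (1 + 3 * j) ≡⟨ double (fib (1 + 3 * j)) (blocks j) ⟩
    (blocks j + fib (1 + 3 * j)) * 2                 ∎
    where
    open ≡-Reasoning
    double : ∀ a b → a + b * 2 + a ≡ (b + a) * 2
    double = solve-∀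

  side≡blocks : ∀ j → side j ≡ blocks j
  side≡blocks j = trans (cong (_/ 2) (fib-3*-blocks j)) (m*n/n≡m (blocks j) 2)

side-suc : ∀ j → side (suc j) ≡ side j + fib (1 + 3 * j)
side-suc j = trans (side≡blocks (suc j)) (cong (_+ fib (1 + 3 * j)) (sym (side≡blocks j)))

fib-3*≡2*side : ∀ j → fib (3 * j) ≡ 2 * side j
fib-3*≡2*side j = trans (fib-3*-blocks j) (trans (*-comm (blocks j) 2) (cong (2 *_) (sym (side≡blocks j))))

-- Growing the side of the square from m = side j to side (j + 1) = m + L adds an L-shaped layer.
layer : ℕ → ℕ → ℕ
layer j x = T (x + m) m L + T (x + m) (m + L) L
  where
  m = side j
  L = fib (1 + 3 * j)

T-layer : ∀ j x → T x (side (suc j)) (side (suc j)) ≡ T x (side j) (side j) + layer j x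
T-layer j x = trans (cong (λ s → T x s s) (side-suc j))
  (trans (T-split x (side j) (fib (1 + 3 * j))) (+-assoc (T x (side j) (side j)) _ _))

T≡Σ-layers : ∀ n x → T x (side n) (side n) ≡ Σ< n (λ j → layer j x)
T≡Σ-layers zero    x = refl
T≡Σ-layers (suc n) x = trans (T-layer n x) (cong (_+ layer n x) (T≡Σ-layers n x))

count : (ℕ → ℕ) → ℕ → ℕ → ℕ
count s y A = Σ< A (λ a → s (y + a))

record Sparse (B : ℕ) (s : ℕ → ℕ) : Set where
  field
    bit : ∀ z → s z ≤ 1
    gap : ∀ z D → 0 < D → D < B → s z ≡ 1 → ¬ s (z + D) ≡ 1

module _ {B : ℕ} {s : ℕ → ℕ} (sparse : Sparse B s) where
  open Sparse sparse

  count≤1 : ∀ y A → A ≤ B → count s y A ≤ 1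
  count≤1 y zero    _     = z≤n
  count≤1 y (suc A) 1+A≤B with s (y + A) in s[y+A] | bit (y + A)
  ... | 0    | _     = subst (_≤ 1) (sym (+-identityʳ _)) (count≤1 y A (≤-trans (n≤1+n A) 1+A≤B))
  ... | 2+ _ | s≤s ()
  ... | 1    | _     = subst (λ c → c + 1 ≤ 1) (sym (n≤0⇒n≡0 (≮⇒≥ no-earlier-1))) ≤-refl
    where
    no-earlier-1 : ¬ 0 < count s y A
    no-earlier-1 0<count with Σ<-positive A (λ a → s (y + a)) 0<count
    ... | a , a<A , 0<s[y+a] = gap (y + a) (A ∸ a) (m<n⇒0<n∸m a<A) (≤-<-trans (m∸n≤m A a) 1+A≤B)
      (≤-antisym (bit (y + a)) 0<s[y+a])
      (trans (cong s (trans (+-assoc y a (A ∸ a)) (cong (y +_) (m+[n∸m]≡n (<⇒≤ a<A))))) s[y+A])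

  count-split : ∀ y m L → count s y (m + L) ≡ count s y m + count s (y + m) L
  count-split y m L = trans (Σ<-split m L (λ a → s (y + a)))
    (cong (count s y m +_) (Σ<-cong L (λ k → cong s (sym (+-assoc y m k)))))

  pair≤2 : ∀ y m L → m + L ≤ B → count s y m + count s y (m + L) ≤ 2
  pair≤2 y m L m+L≤B = +-mono-≤ (count≤1 y m (≤-trans (m≤m+n m L) m+L≤B)) (count≤1 y (m + L) m+L≤B)

  pair-right : ∀ y m L {a} → m + L ≤ B → a < L → s (y + m + a) ≡ 1 → count s y m + count s y (m + L) ≡ 1
  pair-right y m L {a} m+L≤B a<L s≡1 = cong₂ _+_ left≡0 total≡1
    where
    1≤right : 1 ≤ count s (y + m) L
    1≤right = subst (_≤ count s (y + m) L) s≡1 (term≤Σ< L (λ k → s (y + m + k)) a<L)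
    total≤1 : count s y m + count s (y + m) L ≤ 1
    total≤1 = subst (_≤ 1) (count-split y m L) (count≤1 y (m + L) m+L≤B)
    left≡0 : count s y m ≡ 0
    left≡0 = n≤0⇒n≡0 (+-cancelʳ-≤ 1 _ 0 (≤-trans (+-monoʳ-≤ (count s y m) 1≤right) total≤1))
    total≡1 : count s y (m + L) ≡ 1
    total≡1 = ≤-antisym (count≤1 y (m + L) m+L≤B)
      (subst (1 ≤_) (sym (count-split y m L)) (≤-trans 1≤right (m≤n+m _ _)))

  pair-left : ∀ y m L {a} → m + L ≤ B → a < m → s (y + a) ≡ 1 → count s y m + count s y (m + L) ≡ 2
  pair-left y m L {a} m+L≤B a<m s≡1 = cong₂ _+_ left≡1 total≡1
    where
    1≤left : 1 ≤ count s y m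
    1≤left = subst (_≤ count s y m) s≡1 (term≤Σ< m (λ k → s (y + k)) a<m)
    left≡1 : count s y m ≡ 1
    left≡1 = ≤-antisym (count≤1 y m (≤-trans (m≤m+n m L) m+L≤B)) 1≤left
    total≡1 : count s y (m + L) ≡ 1
    total≡1 = ≤-antisym (count≤1 y (m + L) m+L≤B)
      (subst (1 ≤_) (sym (count-split y m L)) (≤-trans 1≤left (m≤m+n _ _)))

T≡carries : ∀ y A L → T y A L ≡ A * floorγ L + count (λ z → carry z L) (suc y) A
T≡carries y A L = trans (Σ<-cong A (λ a → ones-carry (y + a) L))
  (trans (Σ<-+ A (λ _ → floorγ L) (λ a → carry (suc (y + a)) L)) (cong (_+ count (λ z → carry z L) (suc y) A) (Σ<-const A (floorγ L))))

T+non-carries : ∀ y A L → T y A L + count (λ z → 1 ∸ carry z L) (suc y) A ≡ A * suc (floorγ L)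
T+non-carries y A L = trans (sym (Σ<-+ A (λ a → ones (y + a) L) (λ a → 1 ∸ carry (suc (y + a)) L)))
  (trans (Σ<-cong A complete) (Σ<-const A (suc (floorγ L))))
  where
  complete : ∀ a → ones (y + a) L + (1 ∸ carry (suc (y + a)) L) ≡ suc (floorγ L)
  complete a = trans (cong (_+ (1 ∸ c)) (ones-carry (y + a) L))
    (trans (+-assoc (floorγ L) c (1 ∸ c)) (trans (cong (floorγ L +_) (m+[n∸m]≡n (carry≤1 (suc (y + a)) L))) (+-comm (floorγ L) 1)))
    where c = carry (suc (y + a)) L

side+L≤B : ∀ j → side j + fib (1 + 3 * j) ≤ fib (2 + 3 * j)
side+L≤B j = subst (side j + fib (1 + 3 * j) ≤_) (sym (cong (fib (1 + 3 * j) +_) (fib-3*≡2*side j)))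
  (subst (_≤ fib (1 + 3 * j) + 2 * side j) (+-comm (fib (1 + 3 * j)) (side j))
    (+-monoʳ-≤ (fib (1 + 3 * j)) (m≤m+n (side j) (side j + 0))))

module _ (j : ℕ) where
  private
    m = side j
    L = fib (1 + 3 * j)
    B = fib (2 + 3 * j)
    carries : ℕ → ℕ → ℕ
    carries = count (λ z → carry z L)
    non-carries : ℕ → ℕ → ℕ
    non-carries = count (λ z → 1 ∸ carry z L)

  layer-carries : ∀ x → layer j x ≡ (m * floorγ L + (m + L) * floorγ L)
                                      + (carries (suc (x + m)) m + carries (suc (x + m)) (m + L))
  layer-carries x = trans (cong₂ _+_ (T≡carries (x + m) m L) (T≡carries (x + m) (m + L) L))
    (interchange (m * floorγ L) _ ((m + L) * floorγ L) _)
    where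
    interchange : ∀ a b c d → a + b + (c + d) ≡ a + c + (b + d)
    interchange = solve-∀

  layer-non-carries : ∀ x → layer j x + (non-carries (suc (x + m)) m + non-carries (suc (x + m)) (m + L))
                            ≡ m * suc (floorγ L) + (m + L) * suc (floorγ L)
  layer-non-carries x = trans (interchange (T (x + m) m L) (T (x + m) (m + L) L) _ _)
    (cong₂ _+_ (T+non-carries (x + m) m L) (T+non-carries (x + m) (m + L) L))
    where
    interchange : ∀ a b c d → a + b + (c + d) ≡ a + c + (b + d)
    interchange = solve-∀

  Range : ℕ → Set
  Range w = ∃ λ c → ∀ x → c ≤ layer j x × layer j x ≤ c + w

  range-from-carries : Sparse B (λ z → carry z L) → Range 2
  range-from-carries sparse = c , λ x →
    subst (c ≤_) (sym (layer-carries x)) (m≤m+n c _) ,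
    subst (_≤ c + 2) (sym (layer-carries x)) (+-monoʳ-≤ c (pair≤2 sparse (suc (x + m)) m L (side+L≤B j)))
    where c = m * floorγ L + (m + L) * floorγ L

  range-from-non-carries : Sparse B (λ z → 1 ∸ carry z L) → Range 2
  range-from-non-carries sparse = c′ ∸ 2 , λ x →
    ≤-trans (∸-monoʳ-≤ c′ (pair≤2 sparse (suc (x + m)) m L (side+L≤B j)))
            (≤-reflexive (trans (cong (_∸ w x) (sym (layer-non-carries x))) (m+n∸n≡m (layer j x) (w x)))) ,
    ≤-trans (subst (layer j x ≤_) (layer-non-carries x) (m≤m+n (layer j x) (w x))) (subst (c′ ≤_) (+-comm 2 (c′ ∸ 2)) (m≤n+m∸n c′ 2))
    where
    c′ = m * suc (floorγ L) + (m + L) * suc (floorγ L)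
    w : ℕ → ℕ
    w x = non-carries (suc (x + m)) m + non-carries (suc (x + m)) (m + L)

  private
    B≡L+2m : B ≡ L + 2 * m
    B≡L+2m = cong (L +_) (fib-3*≡2*side j)

  -- Both windows of layer j at x start at x + m + 1, with lengths m and m + L; a 1 at offset m + a with
  -- a < L lies in the longer window only.
  RightSpecial LeftSpecial : (ℕ → ℕ) → ℕ → Set
  RightSpecial s x = ∃ λ a → a < L × s (suc (x + m) + m + a) ≡ 1
  LeftSpecial  s x = ∃ λ a → a < m × s (suc (x + m) + a) ≡ 1

  right-special : ∀ {s} x t i → i < L → x ≡ i + t → s (B + t) ≡ 1 → RightSpecial s x
  right-special {s} x t i i<L refl s≡1 with m≤n⇒∃[o]m+o≡n i<L
  ... | a , 1+i+a≡L = a , subst (a <_) 1+i+a≡L (m<n+m a (s≤s z≤n)) , subst (λ p → s p ≡ 1) position s≡1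
    where
    position : B + t ≡ suc (i + t + m) + m + a
    position = trans (cong (_+ t) (trans B≡L+2m (cong (_+ 2 * m) (sym 1+i+a≡L)))) (regroup i a m t)
      where
      regroup : ∀ i a m t → suc i + a + 2 * m + t ≡ suc (i + t + m) + m + a
      regroup = solve-∀

  left-special : ∀ {s} x t i → i < m → x ≡ i + L + t → s (B + t) ≡ 1 → LeftSpecial s x
  left-special {s} x t i i<m refl s≡1 with m≤n⇒∃[o]m+o≡n i<m
  ... | a , 1+i+a≡m = a , subst (a <_) 1+i+a≡m (m<n+m a (s≤s z≤n)) , subst (λ p → s p ≡ 1) position s≡1
    where
    position : B + t ≡ suc (i + L + t + m) + a
    position = begin
      B + t                       ≡⟨ cong (_+ t) B≡L+2m ⟩
      L + 2 * m + t               ≡⟨ double L m t ⟩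
      L + (m + m) + t             ≡⟨ cong (λ n → L + (m + n) + t) (sym 1+i+a≡m) ⟩
      L + (m + (suc i + a)) + t   ≡⟨ regroup i a L t m ⟩
      suc (i + L + t + m) + a     ∎
      where
      open ≡-Reasoning
      double : ∀ L m t → L + 2 * m + t ≡ L + (m + m) + t
      double = solve-∀
      regroup : ∀ i a L t m → L + (m + (suc i + a)) + t ≡ suc (i + L + t + m) + a
      regroup = solve-∀

  layer-gain-carries : ∀ x₀ x₁ → Sparse B (λ z → carry z L) →
    RightSpecial (λ z → carry z L) x₀ → LeftSpecial (λ z → carry z L) x₁ → suc (layer j x₀) ≡ layer j x₁
  layer-gain-carries x₀ x₁ sparse (a , a<L , s₀) (b , b<m , s₁) = begin
    suc (layer j x₀)   ≡⟨ cong suc (layer-carries x₀) ⟩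
    suc (c + _)        ≡⟨ cong (λ w → suc (c + w)) (pair-right sparse (suc (x₀ + m)) m L (side+L≤B j) a<L s₀) ⟩
    suc (c + 1)        ≡⟨ +-suc c 1 ⟨
    c + 2              ≡⟨ cong (c +_) (pair-left sparse (suc (x₁ + m)) m L (side+L≤B j) b<m s₁) ⟨
    c + _              ≡⟨ layer-carries x₁ ⟨
    layer j x₁         ∎
    where
    open ≡-Reasoning
    c = m * floorγ L + (m + L) * floorγ L

  layer-steady-non-carries : ∀ x₀ x₁ → Sparse B (λ z → 1 ∸ carry z L) →
    RightSpecial (λ z → 1 ∸ carry z L) x₀ → RightSpecial (λ z → 1 ∸ carry z L) x₁ → layer j x₀ ≡ layer j x₁
  layer-steady-non-carries x₀ x₁ sparse (a , a<L , s₀) (b , b<L , s₁) = +-cancelʳ-≡ 1 _ _ (begin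
    layer j x₀ + 1   ≡⟨ cong (layer j x₀ +_) (pair-right sparse (suc (x₀ + m)) m L (side+L≤B j) a<L s₀) ⟨
    layer j x₀ + _   ≡⟨ layer-non-carries x₀ ⟩
    _                ≡⟨ layer-non-carries x₁ ⟨
    layer j x₁ + _   ≡⟨ cong (layer j x₁ +_) (pair-right sparse (suc (x₁ + m)) m L (side+L≤B j) b<L s₁) ⟩
    layer j x₁ + 1   ∎)
    where open ≡-Reasoning

carries-sparse : ∀ m → Sparse (fib (3 + 2 * m)) (λ z → carry z (fib (2 + 2 * m)))
carries-sparse m = record { bit = λ z → carry≤1 z (fib (2 + 2 * m)) ; gap = carry-sparse-odd m }

1∸c≡1⇒c≡0 : ∀ {c} → 1 ∸ c ≡ 1 → c ≡ 0
1∸c≡1⇒c≡0 {zero}        _ = refl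
1∸c≡1⇒c≡0 {suc zero}    ()
1∸c≡1⇒c≡0 {suc (suc _)} ()

non-carries-sparse : ∀ m → Sparse (fib (2 + 2 * m)) (λ z → 1 ∸ carry z (fib (1 + 2 * m)))
non-carries-sparse m = record
  { bit = λ z → m∸n≤m 1 (carry z (fib (1 + 2 * m)))
  ; gap = λ z D 0<D D<B s₁ s₂ → carry-sparse-even m z D 0<D D<B (1∸c≡1⇒c≡0 s₁) (1∸c≡1⇒c≡0 s₂)
  }

data EvenOrOdd : ℕ → Set where
  even : ∀ u → EvenOrOdd (2 * u)
  odd  : ∀ u → EvenOrOdd (1 + 2 * u)

even-or-odd : ∀ n → EvenOrOdd n
even-or-odd zero    = even 0
even-or-odd (suc n) with even-or-odd n
... | even u = odd u
... | odd  u = subst EvenOrOdd (*-suc 2 u) (even (suc u))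

3*even : ∀ u → 3 * (2 * u) ≡ 2 * (3 * u)
3*even = solve-∀

3*odd : ∀ u → 3 * (1 + 2 * u) ≡ 1 + 2 * (1 + 3 * u)
3*odd = solve-∀

-- Level j adds windows of length F(3j+1): carries are rare for odd j, non-carries for even j.
even-level-sparse : ∀ u → Sparse (fib (2 + 3 * (2 * u))) (λ z → 1 ∸ carry z (fib (1 + 3 * (2 * u))))
even-level-sparse u = subst (λ k → Sparse (fib (2 + k)) (λ z → 1 ∸ carry z (fib (1 + k)))) (sym (3*even u))
  (non-carries-sparse (3 * u))

odd-level-sparse : ∀ u → Sparse (fib (2 + 3 * (1 + 2 * u))) (λ z → carry z (fib (1 + 3 * (1 + 2 * u))))
odd-level-sparse u = subst (λ k → Sparse (fib (2 + k)) (λ z → carry z (fib (1 + k)))) (sym (3*odd u))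
  (carries-sparse (1 + 3 * u))

layer-range : ∀ j → Range j 2
layer-range j with even-or-odd j
... | even u = range-from-non-carries (2 * u) (even-level-sparse u)
... | odd  u = range-from-carries (1 + 2 * u) (odd-level-sparse u)

-- Upper bound

T-range : ∀ n → ∃ λ c → ∀ x → c ≤ T x (side n) (side n) × T x (side n) (side n) ≤ c + 2 * n
T-range n = Σ< n c , λ x → lower x , upper x
  where
  c : ℕ → ℕ
  c j = proj₁ (layer-range j)
  lower : ∀ x → Σ< n c ≤ T x (side n) (side n)
  lower x = subst (Σ< n c ≤_) (sym (T≡Σ-layers n x)) (Σ<-mono-≤ n (λ j → proj₁ (proj₂ (layer-range j) x)))
  upper : ∀ x → T x (side n) (side n) ≤ Σ< n c + 2 * n
  upper x = begin
    T x (side n) (side n)     ≡⟨ T≡Σ-layers n x ⟩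
    Σ< n (λ j → layer j x)    ≤⟨ Σ<-mono-≤ n (λ j → proj₂ (proj₂ (layer-range j) x)) ⟩
    Σ< n (λ j → c j + 2)      ≡⟨ Σ<-+ n c (λ _ → 2) ⟩
    Σ< n c + Σ< n (λ _ → 2)   ≡⟨ cong (Σ< n c +_) (trans (Σ<-const n 2) (*-comm n 2)) ⟩
    Σ< n c + 2 * n            ∎
    where open ≤-Reasoning

∈-─ : ∀ {x y} {ys : List ℕ} (x∈ys : x ∈ ys) → y ∈ ys → x ≢ y → y ∈ ys ─ x∈ys
∈-─ (here refl) (here refl)  x≢y = contradiction refl x≢y
∈-─ (here _)    (there y∈ys) _   = y∈ys
∈-─ (there _)   (here refl)  _   = here refl
∈-─ (there x∈ys) (there y∈ys) x≢y = there (∈-─ x∈ys y∈ys x≢y)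

unique⊆⇒length≤ : ∀ {xs ys : List ℕ} → Unique xs → All (_∈ ys) xs → length xs ≤ length ys
unique⊆⇒length≤ []                  []                = z≤n
unique⊆⇒length≤ {ys = ys} (x∉xs ∷ xs-unique) (x∈ys ∷ xs⊆ys) =
  subst (_ ≤_) (sym (length-removeAt′ ys (Any.index x∈ys)))
    (s≤s (unique⊆⇒length≤ xs-unique (All.zipWith (λ (x≢y , y∈ys) → ∈-─ x∈ys y∈ys x≢y) (x∉xs , xs⊆ys))))

∈-interval : ∀ {b w v} → b ≤ v → v ≤ b + w → v ∈ applyUpTo (b +_) (suc w)
∈-interval {b} {w} b≤v v≤b+w with m≤n⇒∃[o]m+o≡n b≤v
... | d , refl = ∈-applyUpTo⁺ (b +_) (s≤s (+-cancelˡ-≤ b d w v≤b+w))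

Attained : ℕ → ℕ → Set
Attained n v = ∃ λ i → T i (side n) (side n) ≡ v

distinct-values-≤ : ∀ n → 1 ≤ n → (L : List ℕ) → Unique L → All (Attained n) L → length L ≤ 3 * n
distinct-values-≤ n 1≤n L L-unique L-attained with T-range n
... | c , bounds = begin
  length L                                ≤⟨ unique⊆⇒length≤ L-unique (All.map in-range L-attained) ⟩
  length (applyUpTo (c +_) (suc (2 * n))) ≡⟨ length-applyUpTo (c +_) (suc (2 * n)) ⟩
  1 + 2 * n                               ≤⟨ +-monoˡ-≤ (2 * n) 1≤n ⟩
  3 * n                                   ∎
  where
  open ≤-Reasoning
  in-range : ∀ {v} → Attained n v → v ∈ applyUpTo (c +_) (suc (2 * n))
  in-range (i , refl) = ∈-interval (proj₁ (bounds i)) (proj₂ (bounds i))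

-- Lower bound

discrete-intermediate-value : ∀ (f : ℕ → ℕ) → (∀ i → f (suc i) ≤ suc (f i)) →
                              ∀ I {v} → f 0 ≤ v → v ≤ f I → ∃ λ i → f i ≡ v
discrete-intermediate-value f step zero    f0≤v v≤f0   = 0 , ≤-antisym f0≤v v≤f0
discrete-intermediate-value f step (suc I) {v} f0≤v v≤fI+1 with v ≤? f I
... | yes v≤fI = discrete-intermediate-value f step I f0≤v v≤fI
... | no  v≰fI = suc I , ≤-antisym (≤-trans (step I) (≰⇒> v≰fI)) v≤fI+1

interval-attained : ∀ n I R → T 0 (side n) (side n) + R ≤ T I (side n) (side n) →
                    Σ (List ℕ) λ L → Unique L × All (Attained n) L × length L ≡ suc R
interval-attained n I R T₀+R≤T₁ =
  applyUpTo (T₀ +_) (suc R) ,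
  Unique.applyUpTo⁺₁ (T₀ +_) (suc R) (λ i<j _ eq → <⇒≢ i<j (+-cancelˡ-≡ T₀ _ _ eq)) ,
  All.applyUpTo⁺₁ (T₀ +_) (suc R) (λ {i} i<1+R → discrete-intermediate-value (λ x → T x (side n) (side n)) (T-walk (side n)) I
    (m≤m+n T₀ i) (≤-trans (+-monoʳ-≤ T₀ (≤-pred i<1+R)) T₀+R≤T₁)) ,
  length-applyUpTo (T₀ +_) (suc R)
  where T₀ = T 0 (side n) (side n)

fibTail-split : ∀ m r s → fibTail m (r + s) ≡ fibTail m r + fibTail (m + 3 * r) s
fibTail-split m zero    s = cong (λ k → fibTail k s) (sym (+-identityʳ m))
fibTail-split m (suc r) s = begin
  fib (2 + 2 * m) + fibTail (3 + m) (r + s)                                ≡⟨ cong (fib (2 + 2 * m) +_) (fibTail-split (3 + m) r s) ⟩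
  fib (2 + 2 * m) + (fibTail (3 + m) r + fibTail (3 + m + 3 * r) s)        ≡⟨ +-assoc (fib (2 + 2 * m)) _ _ ⟨
  fib (2 + 2 * m) + fibTail (3 + m) r + fibTail (3 + m + 3 * r) s          ≡⟨ cong (λ k → fibTail m (suc r) + fibTail k s) (shift m r) ⟩
  fib (2 + 2 * m) + fibTail (3 + m) r + fibTail (m + 3 * suc r) s          ∎
  where
  open ≡-Reasoning
  shift : ∀ m r → 3 + m + 3 * r ≡ m + 3 * suc r
  shift = solve-∀

-- Seen from x = 0 the rare event of every level j lies in the right window, at F(3j+2); seen from
-- Σ_{b<K} F(6b+4) it lies at F(3j+2) plus a tail of the sum, in the right window for even j and in the
-- left window for odd j < 2K.
probe : ℕ → ℕ
probe K = fibTail 1 K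

probe-suc : ∀ u → probe (suc u) ≡ probe u + fib (1 + 3 * (1 + 2 * u))
probe-suc u = trans (cong probe (+-comm 1 u)) (trans (fibTail-split 1 u 1)
  (cong (probe u +_) (trans (+-identityʳ _) (cong fib (index u)))))
  where
  index : ∀ u → 2 + 2 * (1 + 3 * u) ≡ 1 + 3 * (1 + 2 * u)
  index = solve-∀

probe-even-split : ∀ {K u} → u ≤ K → probe K ≡ probe u + fibTail (1 + 3 * u) (K ∸ u)
probe-even-split {K} {u} u≤K = trans (cong probe (sym (m+[n∸m]≡n u≤K))) (fibTail-split 1 u (K ∸ u))

probe-odd-split : ∀ {K u} → suc u ≤ K → probe K ≡ probe u + fib (1 + 3 * (1 + 2 * u)) + fibTail (4 + 3 * u) (K ∸ suc u)
probe-odd-split {K} {u} 1+u≤K = trans (cong probe (sym (m+[n∸m]≡n 1+u≤K)))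
  (trans (fibTail-split 1 (suc u) (K ∸ suc u)) (cong₂ _+_ (probe-suc u) (cong (λ k → fibTail k (K ∸ suc u)) (index u))))
  where
  index : ∀ u → 1 + 3 * suc u ≡ 4 + 3 * u
  index = solve-∀

probe<L : ∀ u → probe u < fib (1 + 3 * (2 * u))
probe<L zero    = s≤s z≤n
probe<L (suc u) = begin-strict
  probe (suc u)                          ≡⟨ probe-suc u ⟩
  probe u + fib (1 + 3 * (1 + 2 * u))    <⟨ +-monoˡ-< _ (probe<L u) ⟩
  fib (1 + k) + fib (1 + 3 * (1 + 2 * u)) ≡⟨ cong (λ i → fib (1 + k) + fib (1 + i)) (index₁ u) ⟩
  fib (1 + k) + fib (4 + k)              ≤⟨ +-mono-≤ (fib-mono-≤ (1 + k) 4) (fib-mono-≤ (4 + k) 2) ⟩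
  fib (5 + k) + fib (6 + k)              ≡⟨ +-comm (fib (5 + k)) (fib (6 + k)) ⟩
  fib (7 + k)                            ≡⟨ cong (λ i → fib (1 + i)) (index₂ u) ⟨
  fib (1 + 3 * (2 * suc u))              ∎
  where
  open ≤-Reasoning
  k = 3 * (2 * u)
  index₁ : ∀ u → 3 * (1 + 2 * u) ≡ 3 + 3 * (2 * u)
  index₁ = solve-∀
  index₂ : ∀ u → 3 * (2 * suc u) ≡ 6 + 3 * (2 * u)
  index₂ = solve-∀

probe<side : ∀ u → probe u < side (1 + 2 * u)
probe<side u = <-≤-trans (probe<L u) (subst (fib (1 + 3 * (2 * u)) ≤_) (sym (side-suc (2 * u))) (m≤n+m _ _))

even-level-special : ∀ u r → 1 ∸ carry (fib (2 + 3 * (2 * u)) + fibTail (1 + 3 * u) r) (fib (1 + 3 * (2 * u))) ≡ 1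
even-level-special u r = subst (λ k → 1 ∸ carry (fib (2 + k) + fibTail (1 + 3 * u) r) (fib (1 + k)) ≡ 1) (sym (3*even u))
  (cong (1 ∸_) (special-even (3 * u) r))

odd-level-special : ∀ u r → carry (fib (2 + 3 * (1 + 2 * u)) + fibTail (4 + 3 * u) r) (fib (1 + 3 * (1 + 2 * u))) ≡ 1
odd-level-special u r = subst (λ k → carry (fib (2 + k) + fibTail (4 + 3 * u) r) (fib (1 + k)) ≡ 1) (sym (3*odd u))
  (special-odd (1 + 3 * u) r)

even-level-steady : ∀ K u → u ≤ K → layer (2 * u) 0 ≡ layer (2 * u) (probe K)
even-level-steady K u u≤K = layer-steady-non-carries (2 * u) 0 (probe K) (even-level-sparse u)
  (right-special (2 * u) {s} 0 0 0 (fib-pos (3 * (2 * u))) refl (even-level-special u 0))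
  (right-special (2 * u) {s} (probe K) (fibTail (1 + 3 * u) (K ∸ u)) (probe u) (probe<L u) (probe-even-split u≤K)
    (even-level-special u (K ∸ u)))
  where
  s : ℕ → ℕ
  s z = 1 ∸ carry z (fib (1 + 3 * (2 * u)))

odd-level-gain : ∀ K u → suc u ≤ K → suc (layer (1 + 2 * u) 0) ≡ layer (1 + 2 * u) (probe K)
odd-level-gain K u 1+u≤K = layer-gain-carries (1 + 2 * u) 0 (probe K) (odd-level-sparse u)
  (right-special (1 + 2 * u) {s} 0 0 0 (fib-pos (3 * (1 + 2 * u))) refl (odd-level-special u 0))
  (left-special (1 + 2 * u) {s} (probe K) (fibTail (4 + 3 * u) (K ∸ suc u)) (probe u) (probe<side u) (probe-odd-split 1+u≤K)
    (odd-level-special u (K ∸ suc u)))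
  where
  s : ℕ → ℕ
  s z = carry z (fib (1 + 3 * (1 + 2 * u)))

T-gain-even : ∀ K u → u ≤ K → T 0 (side (2 * u)) (side (2 * u)) + u ≤ T (probe K) (side (2 * u)) (side (2 * u))
T-gain-odd  : ∀ K u → u ≤ K → T 0 (side (1 + 2 * u)) (side (1 + 2 * u)) + u ≤ T (probe K) (side (1 + 2 * u)) (side (1 + 2 * u))

T-gain-even K zero    _     = z≤n
T-gain-even K (suc u) 1+u≤K = subst (λ n → T 0 (side n) (side n) + suc u ≤ T (probe K) (side n) (side n)) (sym (*-suc 2 u))
  (begin
    T 0 (side (2 + 2 * u)) (side (2 + 2 * u)) + suc u   ≡⟨ cong (_+ suc u) (T-layer j 0) ⟩
    T 0 (side j) (side j) + layer j 0 + suc u           ≡⟨ rearrange (T 0 (side j) (side j)) (layer j 0) u ⟩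
    T 0 (side j) (side j) + u + suc (layer j 0)         ≤⟨ +-mono-≤ (T-gain-odd K u (<⇒≤ 1+u≤K)) (≤-reflexive (odd-level-gain K u 1+u≤K)) ⟩
    T (probe K) (side j) (side j) + layer j (probe K)   ≡⟨ T-layer j (probe K) ⟨
    T (probe K) (side (2 + 2 * u)) (side (2 + 2 * u))   ∎)
  where
  open ≤-Reasoning
  j = 1 + 2 * u
  rearrange : ∀ t l u → t + l + suc u ≡ t + u + suc l
  rearrange = solve-∀
T-gain-odd K u u≤K = begin
  T 0 (side (1 + 2 * u)) (side (1 + 2 * u)) + u                        ≡⟨ cong (_+ u) (T-layer (2 * u) 0) ⟩
  T 0 (side (2 * u)) (side (2 * u)) + layer (2 * u) 0 + u              ≡⟨ swap (T 0 (side (2 * u)) (side (2 * u))) (layer (2 * u) 0) u ⟩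
  T 0 (side (2 * u)) (side (2 * u)) + u + layer (2 * u) 0
    ≤⟨ +-mono-≤ (T-gain-even K u u≤K) (≤-reflexive (even-level-steady K u u≤K)) ⟩
  T (probe K) (side (2 * u)) (side (2 * u)) + layer (2 * u) (probe K)  ≡⟨ T-layer (2 * u) (probe K) ⟨
  T (probe K) (side (1 + 2 * u)) (side (1 + 2 * u))                    ∎
  where
  open ≤-Reasoning
  swap : ∀ t l u → t + l + u ≡ t + u + l
  swap = solve-∀

distinct-values-≥ : ∀ n → Σ (List ℕ) λ L → Unique L × All (Attained n) L × n ≤ 2 * length L
distinct-values-≥ n with even-or-odd n
... | even u = let L , L-unique , L-attained , length≡ = interval-attained (2 * u) (probe u) u (T-gain-even u u ≤-refl)
               in L , L-unique , L-attained , subst (λ l → 2 * u ≤ 2 * l) (sym length≡) (*-monoʳ-≤ 2 (n≤1+n u))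
... | odd  u = let L , L-unique , L-attained , length≡ = interval-attained (1 + 2 * u) (probe u) u (T-gain-odd u u ≤-refl)
               in L , L-unique , L-attained ,
                  subst (λ l → 1 + 2 * u ≤ 2 * l) (sym length≡) (subst (1 + 2 * u ≤_) (sym (*-suc 2 u)) (n≤1+n (1 + 2 * u)))

corollary9 : ∃ λ (d : ℕ) → ∃ λ (c : ℕ) → ∃ λ (n₀ : ℕ) → (n : ℕ) → n ≥ n₀ →
  (Σ (List ℕ) (λ L → Unique L × All (λ v → ∃ λ i → T i (side n) (side n) ≡ v) L × n ≤ d * length L))
  × ((L : List ℕ) → Unique L → All (λ v → ∃ λ i → T i (side n) (side n) ≡ v) L → length L ≤ c * n)
corollary9 = 2 , 3 , 1 , λ n 1≤n → distinct-values-≥ n , distinct-values-≤ n 1≤n
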